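{- Let $A\in\mathbb{F}_2[x]$ be odd and perfect. Then, in $\mathbb{F}_2(x)$, $$\frac{A+1}{A}=\sum_{\substack{D\mid A,\ D\neq A\\ A/D\text{ square-free}}}\frac{\sigma(D)}{D}.$$
   Context: A nonzero $A\in\mathbb{F}_2[x]$ is odd if it has no irreducible factor of degree $1$. $\sigma(A)$ is the sum of all divisors of $A$ in $\mathbb{F}_2[x]$; $A$ is perfect if $\sigma(A)=A$. Sums over $D\mid A$ run over all divisors of $A$ in $\mathbb{F}_2[x]$. -}

module Defs where

open import Data.Bool using (Bool; true; false; _xor_; if_then_else_; not)
open import Data.Nat using (ℕ; zero; suc; _∸_; _≤_)
open import Data.List using (List; []; _∷_; _++_; [_]; map; foldr; filter; length; concatMap; upTo)
open import Data.Bool.ListAction using (any)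
import Data.List.Properties as LP
import Data.Bool.Properties as BP
open import Data.Product using (Σ; ∃; _×_; _,_)
open import Data.Sum using (_⊎_)
open import Relation.Nullary using (¬_; does)
open import Relation.Binary.PropositionalEquality using (_≡_)

-- Polynomials over F₂ as little-endian coefficient lists (head = constant term).
-- Lists are not required to be normalised; equality of polynomials is ≈ below.
Poly : Set
Poly = List Bool

_+ₚ_ : Poly → Poly → Poly
[] +ₚ q = q
(a ∷ p) +ₚ [] = a ∷ p
(a ∷ p) +ₚ (b ∷ q) = (a xor b) ∷ (p +ₚ q)

_*ₚ_ : Poly → Poly → Poly
[] *ₚ q = []
(a ∷ p) *ₚ q = (if a then q else []) +ₚ (false ∷ (p *ₚ q))

infixl 6 _+ₚ_
infixl 7 _*ₚ_

oneₚ : Poly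
oneₚ = true ∷ []

cons' : Bool → Poly → Poly
cons' false [] = []
cons' a r = a ∷ r

norm : Poly → Poly
norm [] = []
norm (a ∷ p) = cons' a (norm p)

_≈_ : Poly → Poly → Set
p ≈ q = norm p ≡ norm q

Normalised : Poly → Set
Normalised p = norm p ≡ p

NonZero : Poly → Set
NonZero p = ¬ (norm p ≡ [])

-- degree (the zero polynomial gets degree 0 by convention; only used on nonzero ones)
deg : Poly → ℕ
deg p = length (norm p) ∸ 1

_∣_ : Poly → Poly → Set
D ∣ A = ∃ λ Q → (Q *ₚ D) ≈ A

Irreducible : Poly → Set
Irreducible P = (1 ≤ deg P) × (∀ Q R → (Q *ₚ R) ≈ P → deg Q ≡ 0 ⊎ deg R ≡ 0)

Odd : Poly → Set
Odd A = NonZero A × (∀ P → Irreducible P → deg P ≡ 1 → ¬ (P ∣ A))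

SquareFree : Poly → Set
SquareFree Q = ∀ P → 1 ≤ deg P → ¬ ((P *ₚ P) ∣ Q)

allLists : ℕ → List Poly
allLists zero = [ [] ]
allLists (suc n) = concatMap (λ l → (false ∷ l) ∷ (true ∷ l) ∷ []) (allLists n)

monicUpTo : ℕ → List Poly
monicUpTo d = concatMap (λ k → map (λ l → l ++ [ true ]) (allLists k)) (upTo (suc d))

polysUpTo : ℕ → List Poly
polysUpTo d = allLists (suc d)

_==ₚ_ : Poly → Poly → Bool
p ==ₚ q = does (LP.≡-dec BP._≟_ (norm p) (norm q))

divides? : Poly → Poly → Bool
divides? D A = any (λ Q → (Q *ₚ D) ==ₚ A) (polysUpTo (deg A))

-- the divisors of A in F₂[x] (the only unit is 1, so these are the
-- normalised nonzero polynomials D with D ∣ A; all have degree ≤ deg A)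
divisors : Poly → List Poly
divisors A = filter (λ D → divides? D A ≡? true) (monicUpTo (deg A))
  where
  _≡?_ : (b c : Bool) → _
  b ≡? c = BP._≟_ b c

σ : Poly → Poly
σ A = foldr _+ₚ_ [] (divisors A)

Perfect : Poly → Set
Perfect A = σ A ≈ A

-- F₂(x): fractions num / den, with the usual sum and cross-multiplication equality
Frac : Set
Frac = Poly × Poly

_+f_ : Frac → Frac → Frac
(a , b) +f (c , d) = ((a *ₚ d) +ₚ (c *ₚ b)) , (b *ₚ d)

_≈f_ : Frac → Frac → Set
(a , b) ≈f (c , d) = (a *ₚ d) ≈ (c *ₚ b)

sumF : List Frac → Frac
sumF = foldr _+f_ ([] , oneₚ)

-- Write A = D·F with F squarefree. Expanding σ(D) = Σ_{G ∣ D} G and putting E = G·F, the sum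
-- Σ σ(D)·F over all such D becomes Σ_{E ∣ A} E · #{F squarefree : F ∣ E}. The squarefree divisors
-- of E ≠ 1 pair off as F ↔ F·P for an irreducible P ∣ E, so over F₂ only E = 1 survives and the
-- sum is 1. The term D = A contributes σ(A)·1 = A because A is perfect; the remaining terms thus
-- sum to A + 1, and dividing by A gives the identity.

module Submission where

open import Defs
open import Algebra.Bundles using (CommutativeRing)
open import Data.Bool using (Bool; true; false; _xor_; _∧_; if_then_else_)
open import Data.Bool.ListAction using (any)
open import Data.Bool.Properties using (xor-comm; xor-assoc; xor-same; xor-identityʳ; ∧-distribˡ-xor; ∧-distribʳ-xor; ∧-zeroʳ; ∧-identityʳ; xor-∧-commutativeRing)
import Data.Bool.Properties as BoolP
open import Data.Empty using (⊥-elim)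
open import Data.List using (List; []; _∷_; length; _++_; [_]; replicate; map; filter; foldr; concatMap; upTo)
import Data.List.Properties as ListP
open import Data.List.Membership.Propositional using (_∈_; find; lose)
open import Data.List.Membership.Propositional.Properties using (∈-concatMap⁺; ∈-concatMap⁻; ∈-map⁺; ∈-map⁻; ∈-upTo⁺; ∈-filter⁺; ∈-filter⁻)
open import Data.List.Membership.Propositional.Properties.WithK using (unique∧set⇒bag)
open import Data.List.Relation.Binary.BagAndSetEquality using (∼bag⇒↭)
open import Data.List.Relation.Binary.Permutation.Propositional as Perm using (_↭_)
open import Data.List.Relation.Unary.All as All using ([]; _∷_)
open import Data.List.Relation.Unary.Any using (here; there; any?)
open import Data.List.Relation.Unary.Any.Properties using (any⁺; any⁻)
open import Data.List.Relation.Unary.Unique.Propositional using (Unique; []; _∷_)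
import Data.List.Relation.Unary.Unique.Propositional.Properties as UniqueP
open import Data.Maybe using (nothing)
open import Data.Nat using (ℕ; zero; suc; _+_; _∸_; _≤_; _<_; z≤n; s≤s; _≤?_; _<?_; _≟_)
open import Data.Nat.Properties using (≤-antisym; ≤-refl; ≤-trans; ≤-pred; <-irrefl; <⇒≤; ≮⇒≥; ≰⇒>; m≤n+m; m≤m+n; m+[n∸m]≡n; m≤n⇒m<n∨m≡n; +-comm; suc-injective)
open import Data.Product using (∃; ∃₂; _×_; _,_; proj₁; proj₂)
open import Data.Sum using (_⊎_; inj₁; inj₂)
open import Function using (id; _∘_)
open import Function.Bundles using (_⇔_; Equivalence; mk⇔)
open import Relation.Nullary using (¬_; Dec; does; yes; no)
open import Relation.Nullary.Decidable using (_×-dec_; ¬?)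
open import Relation.Unary using (Pred; Decidable)
open import Relation.Unary.Properties using (∁?)
open import Relation.Binary.PropositionalEquality using (_≡_; refl; sym; trans; cong; cong₂; subst; subst₂)
import Relation.Binary.Reasoning.Setoid as SetoidReasoning
open import Algebra.Properties.CommutativeSemigroup (CommutativeRing.+-commutativeSemigroup xor-∧-commutativeRing) using () renaming (interchange to xor-interchange)
open import Tactic.RingSolver using (solve-∀)
open import Tactic.RingSolver.Core.AlmostCommutativeRing using (AlmostCommutativeRing; fromCommutativeRing)

-- Coefficientwise equality and the ring F₂[x]

coeff : Poly → ℕ → Bool
coeff [] n = false
coeff (a ∷ p) zero = a
coeff (a ∷ p) (suc n) = coeff p n

infix 4 _≐_
record _≐_ (p q : Poly) : Set where
  constructor mk≐
  field at : ∀ n → coeff p n ≡ coeff q n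
open _≐_ public

≐-refl : ∀ {p} → p ≐ p
≐-refl = mk≐ λ n → refl

≐-sym : ∀ {p q} → p ≐ q → q ≐ p
≐-sym e = mk≐ λ n → sym (at e n)

≐-trans : ∀ {p q r} → p ≐ q → q ≐ r → p ≐ r
≐-trans e f = mk≐ λ n → trans (at e n) (at f n)

≐-tail : ∀ {a b p q} → a ∷ p ≐ b ∷ q → p ≐ q
≐-tail e = mk≐ λ n → at e (suc n)

≐-cons : ∀ {a p q} → p ≐ q → a ∷ p ≐ a ∷ q
≐-cons e = mk≐ λ { zero → refl ; (suc n) → at e n }

coeff-cons' : ∀ a r n → coeff (cons' a r) n ≡ coeff (a ∷ r) n
coeff-cons' false [] zero = refl
coeff-cons' false [] (suc n) = refl
coeff-cons' false (x ∷ r) n = refl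
coeff-cons' true r n = refl

coeff-norm : ∀ p n → coeff (norm p) n ≡ coeff p n
coeff-norm [] n = refl
coeff-norm (a ∷ p) zero = coeff-cons' a (norm p) zero
coeff-norm (a ∷ p) (suc n) = trans (coeff-cons' a (norm p) (suc n)) (coeff-norm p n)

norm-≐ : ∀ p → norm p ≐ p
norm-≐ p = mk≐ (coeff-norm p)

≐[]⇒norm≡[] : ∀ q → q ≐ [] → norm q ≡ []
≐[]⇒norm≡[] [] e = refl
≐[]⇒norm≡[] (b ∷ q) e with at e zero | ≐[]⇒norm≡[] q (mk≐ λ n → at e (suc n))
... | refl | r rewrite r = refl

≐⇒≈ : ∀ {p q} → p ≐ q → p ≈ q
≐⇒≈ {[]} {q} e = sym (≐[]⇒norm≡[] q (≐-sym e))
≐⇒≈ {a ∷ p} {[]} e = ≐[]⇒norm≡[] (a ∷ p) e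
≐⇒≈ {a ∷ p} {b ∷ q} e with at e zero
... | refl = cong (cons' a) (≐⇒≈ (≐-tail e))

≈⇒≐ : ∀ {p q} → p ≈ q → p ≐ q
≈⇒≐ {p} {q} e = mk≐ λ n → trans (sym (coeff-norm p n)) (trans (cong (λ r → coeff r n) e) (coeff-norm q n))

coeff-+ₚ : ∀ p q n → coeff (p +ₚ q) n ≡ coeff p n xor coeff q n
coeff-+ₚ [] q n = refl
coeff-+ₚ (a ∷ p) [] n = sym (xor-identityʳ _)
coeff-+ₚ (a ∷ p) (b ∷ q) zero = refl
coeff-+ₚ (a ∷ p) (b ∷ q) (suc n) = coeff-+ₚ p q n

+ₚ-comm : ∀ p q → p +ₚ q ≐ q +ₚ p
+ₚ-comm p q = mk≐ λ n → trans (coeff-+ₚ p q n) (trans (xor-comm (coeff p n) (coeff q n)) (sym (coeff-+ₚ q p n)))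

+ₚ-assoc : ∀ p q r → (p +ₚ q) +ₚ r ≐ p +ₚ (q +ₚ r)
+ₚ-assoc p q r = mk≐ λ n → trans (coeff-+ₚ (p +ₚ q) r n) (trans (cong (_xor coeff r n) (coeff-+ₚ p q n))
  (trans (xor-assoc (coeff p n) (coeff q n) (coeff r n))
  (trans (cong (coeff p n xor_) (sym (coeff-+ₚ q r n))) (sym (coeff-+ₚ p (q +ₚ r) n)))))

+ₚ-identityʳ : ∀ p → p +ₚ [] ≐ p
+ₚ-identityʳ p = mk≐ λ n → trans (coeff-+ₚ p [] n) (xor-identityʳ _)

+ₚ-self : ∀ p → p +ₚ p ≐ []
+ₚ-self p = mk≐ λ n → trans (coeff-+ₚ p p n) (xor-same (coeff p n))

+ₚ-cong : ∀ {p p' q q'} → p ≐ p' → q ≐ q' → p +ₚ q ≐ p' +ₚ q'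
+ₚ-cong {p} {p'} {q} {q'} e f = mk≐ λ n → trans (coeff-+ₚ p q n) (trans (cong₂ _xor_ (at e n) (at f n)) (sym (coeff-+ₚ p' q' n)))

+ₚ-cancelʳ : ∀ p q → (p +ₚ q) +ₚ q ≐ p
+ₚ-cancelʳ p q = ≐-trans (+ₚ-assoc p q q) (≐-trans (+ₚ-cong (≐-refl {p}) (+ₚ-self q)) (+ₚ-identityʳ p))

+ₚ-moveˡ : ∀ a s c → a +ₚ s ≐ c → s ≐ c +ₚ a
+ₚ-moveˡ a s c e = ≐-trans (≐-sym (+ₚ-cancelʳ s a)) (+ₚ-cong (≐-trans (+ₚ-comm s a) e) ≐-refl)

coeff-if : ∀ a q n → coeff (if a then q else []) n ≡ a ∧ coeff q n
coeff-if false q n = refl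
coeff-if true q n = refl

coeff-*ₚ-zero : ∀ a p q → coeff ((a ∷ p) *ₚ q) zero ≡ a ∧ coeff q zero
coeff-*ₚ-zero a p q = trans (coeff-+ₚ (if a then q else []) (false ∷ (p *ₚ q)) zero)
  (trans (xor-identityʳ _) (coeff-if a q zero))

coeff-*ₚ-suc : ∀ a p q n → coeff ((a ∷ p) *ₚ q) (suc n) ≡ (a ∧ coeff q (suc n)) xor coeff (p *ₚ q) n
coeff-*ₚ-suc a p q n = trans (coeff-+ₚ (if a then q else []) (false ∷ (p *ₚ q)) (suc n))
  (cong (_xor coeff (p *ₚ q) n) (coeff-if a q (suc n)))

*ₚ-zeroˡ : ∀ p q → p ≐ [] → p *ₚ q ≐ []
*ₚ-zeroˡ p q e = mk≐ (vanish p e)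
  where
  vanish : ∀ p → p ≐ [] → ∀ n → coeff (p *ₚ q) n ≡ false
  vanish [] e n = refl
  vanish (a ∷ p) e zero with at e zero
  ... | refl = coeff-*ₚ-zero false p q
  vanish (a ∷ p) e (suc n) with at e zero
  ... | refl = trans (coeff-*ₚ-suc false p q n) (vanish p (mk≐ λ m → at e (suc m)) n)

*ₚ-congˡ : ∀ {p p'} q → p ≐ p' → p *ₚ q ≐ p' *ₚ q
*ₚ-congˡ {p} {p'} q e = mk≐ (go p p' e)
  where
  go : ∀ p p' → p ≐ p' → ∀ n → coeff (p *ₚ q) n ≡ coeff (p' *ₚ q) n
  go [] p' e n = sym (at (*ₚ-zeroˡ p' q (≐-sym e)) n)
  go (a ∷ p) [] e n = at (*ₚ-zeroˡ (a ∷ p) q e) n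
  go (a ∷ p) (b ∷ p') e zero with at e zero
  ... | refl = trans (coeff-*ₚ-zero a p q) (sym (coeff-*ₚ-zero a p' q))
  go (a ∷ p) (b ∷ p') e (suc n) with at e zero
  ... | refl = trans (coeff-*ₚ-suc a p q n)
    (trans (cong ((a ∧ coeff q (suc n)) xor_) (go p p' (≐-tail e) n)) (sym (coeff-*ₚ-suc a p' q n)))

*ₚ-congʳ : ∀ p {q q'} → q ≐ q' → p *ₚ q ≐ p *ₚ q'
*ₚ-congʳ p {q} {q'} e = mk≐ (go p)
  where
  go : ∀ p n → coeff (p *ₚ q) n ≡ coeff (p *ₚ q') n
  go [] n = refl
  go (a ∷ p) zero = trans (coeff-*ₚ-zero a p q) (trans (cong (a ∧_) (at e zero)) (sym (coeff-*ₚ-zero a p q')))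
  go (a ∷ p) (suc n) = trans (coeff-*ₚ-suc a p q n)
    (trans (cong₂ (λ c d → (a ∧ c) xor d) (at e (suc n)) (go p n)) (sym (coeff-*ₚ-suc a p q' n)))

*ₚ-cong : ∀ {p p' q q'} → p ≐ p' → q ≐ q' → p *ₚ q ≐ p' *ₚ q'
*ₚ-cong {p} {p'} {q} {q'} e f = ≐-trans (*ₚ-congˡ q e) (*ₚ-congʳ p' f)

*ₚ-distribʳ : ∀ p p' q → (p +ₚ p') *ₚ q ≐ p *ₚ q +ₚ p' *ₚ q
*ₚ-distribʳ p p' q = mk≐ (go p p')
  where
  go : ∀ p p' n → coeff ((p +ₚ p') *ₚ q) n ≡ coeff (p *ₚ q +ₚ p' *ₚ q) n
  go [] p' n = refl
  go (a ∷ p) [] n = sym (trans (coeff-+ₚ ((a ∷ p) *ₚ q) [] n) (xor-identityʳ _))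
  go (a ∷ p) (b ∷ p') zero
    rewrite coeff-*ₚ-zero (a xor b) (p +ₚ p') q | coeff-+ₚ ((a ∷ p) *ₚ q) ((b ∷ p') *ₚ q) zero
          | coeff-*ₚ-zero a p q | coeff-*ₚ-zero b p' q = ∧-distribʳ-xor _ a b
  go (a ∷ p) (b ∷ p') (suc n)
    rewrite coeff-*ₚ-suc (a xor b) (p +ₚ p') q n | coeff-+ₚ ((a ∷ p) *ₚ q) ((b ∷ p') *ₚ q) (suc n)
          | coeff-*ₚ-suc a p q n | coeff-*ₚ-suc b p' q n | go p p' n | coeff-+ₚ (p *ₚ q) (p' *ₚ q) n
          | ∧-distribʳ-xor (coeff q (suc n)) a b
          = xor-interchange (a ∧ coeff q (suc n)) (b ∧ coeff q (suc n)) (coeff (p *ₚ q) n) (coeff (p' *ₚ q) n)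

*ₚ-distribˡ : ∀ p q q' → p *ₚ (q +ₚ q') ≐ p *ₚ q +ₚ p *ₚ q'
*ₚ-distribˡ p q q' = mk≐ (go p)
  where
  go : ∀ p n → coeff (p *ₚ (q +ₚ q')) n ≡ coeff (p *ₚ q +ₚ p *ₚ q') n
  go [] n = refl
  go (a ∷ p) zero
    rewrite coeff-*ₚ-zero a p (q +ₚ q') | coeff-+ₚ ((a ∷ p) *ₚ q) ((a ∷ p) *ₚ q') zero
          | coeff-*ₚ-zero a p q | coeff-*ₚ-zero a p q' | coeff-+ₚ q q' zero = ∧-distribˡ-xor a _ _
  go (a ∷ p) (suc n)
    rewrite coeff-*ₚ-suc a p (q +ₚ q') n | coeff-+ₚ ((a ∷ p) *ₚ q) ((a ∷ p) *ₚ q') (suc n)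
          | coeff-*ₚ-suc a p q n | coeff-*ₚ-suc a p q' n | go p n | coeff-+ₚ (p *ₚ q) (p *ₚ q') n
          | coeff-+ₚ q q' (suc n) | ∧-distribˡ-xor a (coeff q (suc n)) (coeff q' (suc n))
          = xor-interchange (a ∧ coeff q (suc n)) (a ∧ coeff q' (suc n)) (coeff (p *ₚ q) n) (coeff (p *ₚ q') n)

*ₚ-zeroʳ : ∀ p → p *ₚ [] ≐ []
*ₚ-zeroʳ p = mk≐ (go p)
  where
  go : ∀ p n → coeff (p *ₚ []) n ≡ false
  go [] n = refl
  go (a ∷ p) zero = trans (coeff-*ₚ-zero a p []) (∧-zeroʳ a)
  go (a ∷ p) (suc n) = trans (coeff-*ₚ-suc a p [] n) (trans (cong (_xor coeff (p *ₚ []) n) (∧-zeroʳ a)) (go p n))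

*ₚ-shiftʳ : ∀ p q → p *ₚ (false ∷ q) ≐ false ∷ (p *ₚ q)
*ₚ-shiftʳ p q = mk≐ (go p)
  where
  go : ∀ p n → coeff (p *ₚ (false ∷ q)) n ≡ coeff (false ∷ (p *ₚ q)) n
  go [] zero = refl
  go [] (suc n) = refl
  go (a ∷ p) zero = trans (coeff-*ₚ-zero a p (false ∷ q)) (∧-zeroʳ a)
  go (a ∷ p) (suc zero) rewrite coeff-*ₚ-suc a p (false ∷ q) zero | go p zero | coeff-*ₚ-zero a p q = xor-identityʳ _
  go (a ∷ p) (suc (suc n)) rewrite coeff-*ₚ-suc a p (false ∷ q) (suc n) | go p (suc n) | coeff-*ₚ-suc a p q n = refl

*ₚ-identityʳ : ∀ p → p *ₚ oneₚ ≐ p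
*ₚ-identityʳ p = mk≐ (go p)
  where
  go : ∀ p n → coeff (p *ₚ oneₚ) n ≡ coeff p n
  go [] n = refl
  go (a ∷ p) zero = trans (coeff-*ₚ-zero a p oneₚ) (∧-identityʳ a)
  go (a ∷ p) (suc n) = trans (coeff-*ₚ-suc a p oneₚ n) (trans (cong (_xor coeff (p *ₚ oneₚ) n) (∧-zeroʳ a)) (go p n))

*ₚ-identityˡ : ∀ p → oneₚ *ₚ p ≐ p
*ₚ-identityˡ p = mk≐ λ n → trans (coeff-+ₚ p (false ∷ []) n) (go n)
  where
  go : ∀ n → coeff p n xor coeff (false ∷ []) n ≡ coeff p n
  go zero = xor-identityʳ _
  go (suc zero) = xor-identityʳ _
  go (suc (suc n)) = xor-identityʳ _

*ₚ-comm : ∀ p q → p *ₚ q ≐ q *ₚ p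
*ₚ-comm [] q = ≐-sym (*ₚ-zeroʳ q)
*ₚ-comm (a ∷ p) q =
  ≐-trans (+ₚ-cong (constant a) (≐-cons (*ₚ-comm p q)))
  (≐-trans (+ₚ-cong ≐-refl (≐-sym (*ₚ-shiftʳ q p)))
  (≐-trans (≐-sym (*ₚ-distribˡ q (if a then oneₚ else []) (false ∷ p)))
           (*ₚ-congʳ q (≐-sym (split a)))))
  where
  constant : ∀ a → (if a then q else []) ≐ q *ₚ (if a then oneₚ else [])
  constant false = ≐-sym (*ₚ-zeroʳ q)
  constant true = ≐-sym (*ₚ-identityʳ q)
  split : ∀ a → a ∷ p ≐ (if a then oneₚ else []) +ₚ (false ∷ p)
  split false = ≐-refl
  split true = mk≐ λ { zero → refl ; (suc n) → refl }

*ₚ-assoc : ∀ p q r → (p *ₚ q) *ₚ r ≐ p *ₚ (q *ₚ r)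
*ₚ-assoc [] q r = ≐-refl
*ₚ-assoc (a ∷ p) q r =
  ≐-trans (*ₚ-distribʳ (if a then q else []) (false ∷ (p *ₚ q)) r)
          (+ₚ-cong (constant a) (≐-cons (*ₚ-assoc p q r)))
  where
  constant : ∀ a → (if a then q else []) *ₚ r ≐ (if a then q *ₚ r else [])
  constant false = ≐-refl
  constant true = ≐-refl

-- Negation is the identity in characteristic 2.
poly-commutativeRing : CommutativeRing _ _
poly-commutativeRing = record
  { Carrier = Poly ; _≈_ = _≐_ ; _+_ = _+ₚ_ ; _*_ = _*ₚ_ ; -_ = id ; 0# = [] ; 1# = oneₚ
  ; isCommutativeRing = record
    { isRing = record
      { +-isAbelianGroup = record
        { isGroup = record
          { isMonoid = record
            { isSemigroup = record
              { isMagma = record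
                { isEquivalence = record { refl = ≐-refl ; sym = ≐-sym ; trans = ≐-trans }
                ; ∙-cong = +ₚ-cong }
              ; assoc = +ₚ-assoc }
            ; identity = (λ p → ≐-refl) , +ₚ-identityʳ }
          ; inverse = +ₚ-self , +ₚ-self
          ; ⁻¹-cong = id }
        ; comm = +ₚ-comm }
      ; *-cong = *ₚ-cong
      ; *-assoc = *ₚ-assoc
      ; *-identity = *ₚ-identityˡ , *ₚ-identityʳ
      ; distrib = *ₚ-distribˡ , (λ r p q → *ₚ-distribʳ p q r) }
    ; *-comm = *ₚ-comm } }

poly-ring : AlmostCommutativeRing _ _
poly-ring = fromCommutativeRing poly-commutativeRing (λ _ → nothing)

module ≐-Reasoning = SetoidReasoning (CommutativeRing.setoid poly-commutativeRing)

-- Length, division with remainder and Euclid's lemma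

len : Poly → ℕ
len p = length (norm p)

LengthBound : Poly → ℕ → Set
LengthBound p n = ∀ i → n ≤ i → coeff p i ≡ false

len-bound : ∀ p → LengthBound p (len p)
len-bound p i h = trans (sym (coeff-norm p i)) (beyond (norm p) i h)
  where
  beyond : ∀ r i → length r ≤ i → coeff r i ≡ false
  beyond [] i h = refl
  beyond (a ∷ r) (suc i) (s≤s h) = beyond r i h

coeff-len-last : ∀ p k → len p ≡ suc k → coeff p k ≡ true
coeff-len-last p k e = trans (sym (coeff-norm p k)) (last p k e)
  where
  last : ∀ p k → length (norm p) ≡ suc k → coeff (norm p) k ≡ true
  last [] k ()
  last (a ∷ p) k e with norm p in eq
  last (false ∷ p) k () | []
  last (true ∷ p) zero e | [] = refl
  last (false ∷ p) zero () | b ∷ r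
  last (true ∷ p) zero () | b ∷ r
  last (false ∷ p) (suc k) e | b ∷ r = subst (λ z → coeff z k ≡ true) eq (last p k (trans (cong length eq) (suc-injective e)))
  last (true ∷ p) (suc k) e | b ∷ r = subst (λ z → coeff z k ≡ true) eq (last p k (trans (cong length eq) (suc-injective e)))

true⇒<len : ∀ p k → coeff p k ≡ true → k < len p
true⇒<len p k e with k <? len p
... | yes h = h
... | no h with trans (sym e) (len-bound p k (≮⇒≥ h))
...   | ()

bound⇒len≤ : ∀ p n → LengthBound p n → len p ≤ n
bound⇒len≤ p n b with len p in eq
... | zero = z≤n
... | suc k with k <? n
...   | yes h = h
...   | no h with trans (sym (b k (≮⇒≥ h))) (coeff-len-last p k eq)
...     | ()

len-cong : ∀ {p q} → p ≐ q → len p ≡ len q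
len-cong e = cong length (≐⇒≈ e)

len≡0⇒≐[] : ∀ p → len p ≡ 0 → p ≐ []
len≡0⇒≐[] p e = mk≐ λ i → len-bound p i (subst (_≤ i) (sym e) z≤n)

nonZero⇒len≡suc : ∀ p → NonZero p → ∃ λ k → len p ≡ suc k
nonZero⇒len≡suc p nz with len p in eq
... | zero = ⊥-elim (nz (≐⇒≈ (len≡0⇒≐[] p eq)))
... | suc k = k , refl

len≡suc⇒nonZero : ∀ p k → len p ≡ suc k → NonZero p
len≡suc⇒nonZero p k e h with trans (sym e) (cong length h)
... | ()

*ₚ-bound : ∀ p q a b → LengthBound p a → LengthBound q (suc b) → LengthBound (p *ₚ q) (a + b)
*ₚ-bound [] q a b bp bq i h = refl
*ₚ-bound (c ∷ p) q zero b bp bq i h = at (*ₚ-zeroˡ (c ∷ p) q (mk≐ λ j → bp j z≤n)) i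
*ₚ-bound (c ∷ p) q (suc a) b bp bq (suc i) (s≤s h)
  rewrite coeff-*ₚ-suc c p q i | bq (suc i) (s≤s (≤-trans (m≤n+m b a) h)) | ∧-zeroʳ c
  = *ₚ-bound p q a b (λ j h' → bp (suc j) (s≤s h')) bq i h

coeff-*ₚ-top : ∀ p q a b → LengthBound p (suc a) → LengthBound q (suc b) → coeff (p *ₚ q) (a + b) ≡ coeff p a ∧ coeff q b
coeff-*ₚ-top [] q a b bp bq = refl
coeff-*ₚ-top (c ∷ p) q zero zero bp bq = coeff-*ₚ-zero c p q
coeff-*ₚ-top (c ∷ p) q zero (suc b) bp bq
  rewrite coeff-*ₚ-suc c p q b | at (*ₚ-zeroˡ p q (mk≐ λ j → bp (suc j) (s≤s z≤n))) b = xor-identityʳ _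
coeff-*ₚ-top (c ∷ p) q (suc a) b bp bq
  rewrite coeff-*ₚ-suc c p q (a + b) | bq (suc (a + b)) (s≤s (m≤n+m b a)) | ∧-zeroʳ c
  = coeff-*ₚ-top p q a b (λ j h' → bp (suc j) (s≤s h')) bq

len-*ₚ : ∀ p q a b → len p ≡ suc a → len q ≡ suc b → len (p *ₚ q) ≡ suc (a + b)
len-*ₚ p q a b ep eq = ≤-antisym
  (bound⇒len≤ (p *ₚ q) (suc (a + b)) (*ₚ-bound p q (suc a) b bp bq))
  (true⇒<len (p *ₚ q) (a + b) top)
  where
  bp : LengthBound p (suc a)
  bp = subst (LengthBound p) ep (len-bound p)
  bq : LengthBound q (suc b)
  bq = subst (LengthBound q) eq (len-bound q)
  top : coeff (p *ₚ q) (a + b) ≡ true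
  top rewrite coeff-*ₚ-top p q a b bp bq | coeff-len-last p a ep | coeff-len-last q b eq = refl

*ₚ-nonZero : ∀ p q → NonZero p → NonZero q → NonZero (p *ₚ q)
*ₚ-nonZero p q np nq with nonZero⇒len≡suc p np | nonZero⇒len≡suc q nq
... | a , ea | b , eb = len≡suc⇒nonZero (p *ₚ q) (a + b) (len-*ₚ p q a b ea eb)

*ₚ-cancelʳ : ∀ a b c → NonZero c → a *ₚ c ≐ b *ₚ c → a ≐ b
*ₚ-cancelʳ a b c nc e with norm (a +ₚ b) in eq
... | [] = mk≐ λ n → sum-zero (coeff a n) (coeff b n)
  (trans (sym (coeff-+ₚ a b n)) (trans (sym (coeff-norm (a +ₚ b) n)) (cong (λ r → coeff r n) eq)))
  where
  sum-zero : ∀ x y → x xor y ≡ false → x ≡ y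
  sum-zero false false _ = refl
  sum-zero true true _ = refl
... | x ∷ r = ⊥-elim (*ₚ-nonZero (a +ₚ b) c (λ h → cons≢[] (trans (sym eq) h)) nc (≐⇒≈ zero-product))
  where
  cons≢[] : ¬ (x ∷ r ≡ [])
  cons≢[] ()
  zero-product : (a +ₚ b) *ₚ c ≐ []
  zero-product = ≐-trans (*ₚ-distribʳ a b c) (≐-trans (+ₚ-cong e ≐-refl) (+ₚ-self (b *ₚ c)))

xpow : ℕ → Poly
xpow zero = oneₚ
xpow (suc m) = false ∷ xpow m

len-xpow : ∀ m → len (xpow m) ≡ suc m
len-xpow m = trans (cong length (normalised m)) (length-xpow m)
  where
  normalised : ∀ m → norm (xpow m) ≡ xpow m
  normalised zero = refl
  normalised (suc zero) = refl
  normalised (suc (suc m)) rewrite normalised (suc m) = refl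
  length-xpow : ∀ m → length (xpow m) ≡ suc m
  length-xpow zero = refl
  length-xpow (suc m) = cong suc (length-xpow m)

len-+ₚ-cancel : ∀ p q j → len p ≡ suc j → len q ≡ suc j → len (p +ₚ q) ≤ j
len-+ₚ-cancel p q j ep eq = bound⇒len≤ (p +ₚ q) j bound
  where
  bound : LengthBound (p +ₚ q) j
  bound i j≤i with m≤n⇒m<n∨m≡n j≤i
  ... | inj₂ refl = trans (coeff-+ₚ p q j) (cong₂ _xor_ (coeff-len-last p j ep) (coeff-len-last q j eq))
  ... | inj₁ j<i = trans (coeff-+ₚ p q i)
    (cong₂ _xor_ (len-bound p i (subst (_≤ i) (sym ep) j<i)) (len-bound q i (subst (_≤ i) (sym eq) j<i)))

len-cancel-leading : ∀ d k p j → len d ≡ suc k → len p ≡ suc j → k ≤ j → len (p +ₚ xpow (j ∸ k) *ₚ d) ≤ j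
len-cancel-leading d k p j ed ep k≤j = len-+ₚ-cancel p (xpow (j ∸ k) *ₚ d) j ep
  (trans (len-*ₚ (xpow (j ∸ k)) d (j ∸ k) k (len-xpow (j ∸ k)) ed) (cong suc (trans (+-comm (j ∸ k) k) (m+[n∸m]≡n k≤j))))

divMod-fuel : ∀ d k → len d ≡ suc k → ∀ f p → len p ≤ f → ∃₂ λ q r → p ≐ q *ₚ d +ₚ r × len r ≤ k
divMod-fuel d k ed zero p h = [] , p , ≐-refl , ≤-trans h z≤n
divMod-fuel d k ed (suc f) p h with len p ≤? k
... | yes small = [] , p , ≐-refl , small
... | no big with len p in ep
...   | zero = ⊥-elim (big z≤n)
...   | suc j with q , r , e , lr ← divMod-fuel d k ed f (p +ₚ xpow (j ∸ k) *ₚ d) (≤-trans (len-cancel-leading d k p j ed ep (≤-pred (≰⇒> big))) (≤-pred h)) =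
  q +ₚ xpow (j ∸ k) , r , ≐-trans (≐-sym (+ₚ-cancelʳ p t)) (≐-trans (+ₚ-cong e ≐-refl) (regroup q (xpow (j ∸ k)) d r)) , lr
  where
  t = xpow (j ∸ k) *ₚ d
  regroup : ∀ a b c s → (a *ₚ c +ₚ s) +ₚ b *ₚ c ≐ (a +ₚ b) *ₚ c +ₚ s
  regroup = solve-∀ poly-ring

divMod : ∀ d p → NonZero d → ∃₂ λ q r → p ≐ q *ₚ d +ₚ r × len r < len d
divMod d p nd with k , ed ← nonZero⇒len≡suc d nd with q , r , e , lr ← divMod-fuel d k ed (len p) p ≤-refl =
  q , r , e , subst (len r <_) (sym ed) (s≤s lr)

infix 4 _∣ₚ_
_∣ₚ_ : Poly → Poly → Set
D ∣ₚ A = ∃ λ Q → Q *ₚ D ≐ A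

∣⇒∣ₚ : ∀ {D A} → D ∣ A → D ∣ₚ A
∣⇒∣ₚ (Q , e) = Q , ≈⇒≐ e

∣ₚ⇒∣ : ∀ {D A} → D ∣ₚ A → D ∣ A
∣ₚ⇒∣ (Q , e) = Q , ≐⇒≈ e

∣ₚ-refl : ∀ D → D ∣ₚ D
∣ₚ-refl D = oneₚ , *ₚ-identityˡ D

∣ₚ-trans : ∀ {a b c} → a ∣ₚ b → b ∣ₚ c → a ∣ₚ c
∣ₚ-trans {a} (x , ex) (y , ey) = y *ₚ x , ≐-trans (*ₚ-assoc y x a) (≐-trans (*ₚ-congʳ y ex) ey)

∣ₚ-resp : ∀ {a a' b b'} → a ≐ a' → b ≐ b' → a ∣ₚ b → a' ∣ₚ b'
∣ₚ-resp ea eb (x , e) = x , ≐-trans (*ₚ-congʳ x (≐-sym ea)) (≐-trans e eb)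

∣ₚ-*ₚʳ : ∀ a b → a ∣ₚ a *ₚ b
∣ₚ-*ₚʳ a b = b , *ₚ-comm b a

∣ₚ-cancelˡ : ∀ s x y → NonZero s → s *ₚ x ∣ₚ s *ₚ y → x ∣ₚ y
∣ₚ-cancelˡ s x y ns (q , e) = q , *ₚ-cancelʳ (q *ₚ x) y s ns (≐-trans (regroup q x s) (≐-trans e (*ₚ-comm s y)))
  where
  regroup : ∀ q x s → (q *ₚ x) *ₚ s ≐ q *ₚ (s *ₚ x)
  regroup = solve-∀ poly-ring

len≡1⇒≐oneₚ : ∀ p → len p ≡ 1 → p ≐ oneₚ
len≡1⇒≐oneₚ p e = mk≐ λ where
  zero → coeff-len-last p 0 e
  (suc n) → len-bound p (suc n) (subst (_≤ suc n) (sym e) (s≤s z≤n))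

len≥2⇒nonZero : ∀ p → 2 ≤ len p → NonZero p
len≥2⇒nonZero p h e with len p | cong length e
len≥2⇒nonZero p () e | zero | _
len≥2⇒nonZero p (s≤s ()) e | suc zero | _
... | suc (suc k) | ()

len≤1⇒constant : ∀ p → len p ≤ 1 → p ≐ [] ⊎ p ≐ oneₚ
len≤1⇒constant p h with len p in e
... | zero = inj₁ (len≡0⇒≐[] p e)
... | suc zero = inj₂ (len≡1⇒≐oneₚ p e)
len≤1⇒constant p (s≤s ()) | suc (suc _)

deg≡0⇒len≤1 : ∀ p → deg p ≡ 0 → len p ≤ 1
deg≡0⇒len≤1 p e with len p
... | zero = z≤n
... | suc zero = ≤-refl
deg≡0⇒len≤1 p () | suc (suc k)

1≤deg⇒2≤len : ∀ p → 1 ≤ deg p → 2 ≤ len p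
1≤deg⇒2≤len p h with len p
... | suc (suc k) = s≤s (s≤s z≤n)
1≤deg⇒2≤len p () | zero
1≤deg⇒2≤len p () | suc zero

2≤len⇒1≤deg : ∀ p → 2 ≤ len p → 1 ≤ deg p
2≤len⇒1≤deg p h with len p
... | suc (suc k) = s≤s z≤n
2≤len⇒1≤deg p () | zero
2≤len⇒1≤deg p (s≤s ()) | suc zero

irreducible⇒len≥2 : ∀ P → Irreducible P → 2 ≤ len P
irreducible⇒len≥2 P (h , _) = 1≤deg⇒2≤len P h

irreducible⇒nonZero : ∀ P → Irreducible P → NonZero P
irreducible⇒nonZero P irr = len≥2⇒nonZero P (irreducible⇒len≥2 P irr)

irreducible-cofactor : ∀ P → Irreducible P → ∀ q X → q *ₚ X ≐ P → 2 ≤ len X → q ≐ oneₚ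
irreducible-cofactor P irr q X e lX with proj₂ irr q X (≐⇒≈ e)
... | inj₂ d with () ← subst (1 ≤_) d (2≤len⇒1≤deg X lX)
... | inj₁ d with len≤1⇒constant q (deg≡0⇒len≤1 q d)
...   | inj₂ q≐1 = q≐1
...   | inj₁ q≐0 = ⊥-elim (irreducible⇒nonZero P irr (≐⇒≈ (≐-trans (≐-sym e) (*ₚ-zeroˡ q X q≐0))))

irreducible-divisor : ∀ P S → Irreducible P → S ∣ₚ P → 2 ≤ len S → S ≐ P
irreducible-divisor P S irr (q , e) lS =
  ≐-trans (≐-sym (*ₚ-identityˡ S)) (≐-trans (*ₚ-congˡ S (≐-sym (irreducible-cofactor P irr q S e lS))) e)

exact-division : ∀ {a} q b r → a ≐ q *ₚ b +ₚ r → len r ≡ 0 → q *ₚ b ≐ a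
exact-division q b r e r≡0 = ≐-sym (≐-trans e (≐-trans (+ₚ-cong ≐-refl (len≡0⇒≐[] r r≡0)) (+ₚ-identityʳ (q *ₚ b))))

∣ₚ-+ₚ : ∀ {P a b} → P ∣ₚ a → P ∣ₚ b → P ∣ₚ a +ₚ b
∣ₚ-+ₚ {P} (x , ex) (y , ey) = x +ₚ y , ≐-trans (*ₚ-distribʳ x y P) (+ₚ-cong ex ey)

∣ₚ-*ₚˡ : ∀ {P b} q → P ∣ₚ b → P ∣ₚ q *ₚ b
∣ₚ-*ₚˡ {P} q (y , ey) = q *ₚ y , ≐-trans (*ₚ-assoc q y P) (*ₚ-congʳ q ey)

∣ₚ-remainder : ∀ {P a} q b r Y → a ≐ q *ₚ b +ₚ r → P ∣ₚ a *ₚ Y → P ∣ₚ b *ₚ Y → P ∣ₚ r *ₚ Y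
∣ₚ-remainder {P} {a} q b r Y e da db =
  ∣ₚ-resp ≐-refl (≐-sym (≐-trans (*ₚ-congˡ Y (+ₚ-moveˡ (q *ₚ b) r a (≐-sym e))) (expand a q b Y))) (∣ₚ-+ₚ da (∣ₚ-*ₚˡ q db))
  where
  expand : ∀ a q b y → (a +ₚ q *ₚ b) *ₚ y ≐ a *ₚ y +ₚ q *ₚ (b *ₚ y)
  expand = solve-∀ poly-ring

-- Descent on len X: dividing P by X leaves a shorter remainder r with P ∣ r Y.
irreducible-∣ₚ-*ₚ-short : ∀ P → Irreducible P → ∀ f X Y → len X ≤ f → 1 ≤ len X → len X < len P →
  P ∣ₚ X *ₚ Y → P ∣ₚ Y
irreducible-∣ₚ-*ₚ-short P irr zero X Y lf l1 lP dv with () ← ≤-trans l1 lf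
irreducible-∣ₚ-*ₚ-short P irr (suc f) X Y lf l1 lP dv with len X in eX
... | zero with () ← l1
... | suc zero = ∣ₚ-resp ≐-refl (≐-trans (*ₚ-congˡ Y (len≡1⇒≐oneₚ X eX)) (*ₚ-identityˡ Y)) dv
... | suc (suc kx) with divMod X P (len≡suc⇒nonZero X (suc kx) eX)
...   | q , r , eP , lr with len r in er
...     | zero = ⊥-elim (<-irrefl (trans (sym eX) (len-cong X≐P)) lP)
  where
  X≐P : X ≐ P
  X≐P = irreducible-divisor P X irr (q , exact-division q X r eP er) (subst (2 ≤_) (sym eX) (s≤s (s≤s z≤n)))
...     | suc kr = irreducible-∣ₚ-*ₚ-short P irr f r Y
  (subst (_≤ f) (sym er) (≤-pred (≤-trans lr' lf)))
  (subst (1 ≤_) (sym er) (s≤s z≤n))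
  (subst (_< len P) (sym er) (≤-trans lr' (<⇒≤ lP)))
  (∣ₚ-remainder q X r Y eP (∣ₚ-*ₚʳ P Y) dv)
  where
  lr' : suc kr < suc (suc kx)
  lr' = subst (suc kr <_) eX lr

irreducible-prime : ∀ P X Y → Irreducible P → P ∣ₚ X *ₚ Y → ¬ (P ∣ₚ X) → P ∣ₚ Y
irreducible-prime P X Y irr dv P∤X with divMod P X (irreducible⇒nonZero P irr)
... | q , r , eX , lr with len r in er
...   | zero = ⊥-elim (P∤X (q , exact-division q P r eX er))
...   | suc kr = irreducible-∣ₚ-*ₚ-short P irr (len r) r Y ≤-refl
  (subst (1 ≤_) (sym er) (s≤s z≤n)) (subst (_< len P) (sym er) lr) (∣ₚ-remainder q P r Y eX dv (∣ₚ-*ₚʳ P Y))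

-- Deciding divisibility by enumeration

any≡true⇒∃ : ∀ {A : Set} (p : A → Bool) xs → any p xs ≡ true → ∃ λ x → x ∈ xs × p x ≡ true
any≡true⇒∃ p xs e with x , x∈xs , px ← find (any⁻ p xs (Equivalence.from BoolP.T-≡ e)) =
  x , x∈xs , Equivalence.to BoolP.T-≡ px

∈⇒any≡true : ∀ {A : Set} (p : A → Bool) {xs x} → x ∈ xs → p x ≡ true → any p xs ≡ true
∈⇒any≡true p x∈xs px = Equivalence.to BoolP.T-≡ (any⁺ p (lose x∈xs (Equivalence.from BoolP.T-≡ px)))

unique-concatMap : ∀ {A B : Set} (f : A → List B) xs → Unique xs → (∀ x → Unique (f x)) →
  (∀ {x x' y} → y ∈ f x → y ∈ f x' → x ≡ x') → Unique (concatMap f xs)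
unique-concatMap f [] u uf inj = []
unique-concatMap f (x ∷ xs) (x∉xs ∷ u) uf inj = UniqueP.++⁺ (uf x) (unique-concatMap f xs u uf inj) disjoint
  where
  disjoint : ∀ {v} → ¬ (v ∈ f x × v ∈ concatMap f xs)
  disjoint (v∈fx , v∈rest) with x' , x'∈xs , v∈fx' ← find (∈-concatMap⁻ f {xs = xs} v∈rest) =
    All.lookup x∉xs x'∈xs (inj v∈fx v∈fx')

∈-allLists⁻ : ∀ n {l} → l ∈ allLists n → length l ≡ n
∈-allLists⁻ zero (here refl) = refl
∈-allLists⁻ (suc n) m with l , l∈ , y∈ ← find (∈-concatMap⁻ _ {xs = allLists n} m) with y∈
... | here refl = cong suc (∈-allLists⁻ n l∈)
... | there (here refl) = cong suc (∈-allLists⁻ n l∈)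

∈-allLists⁺ : ∀ l → l ∈ allLists (length l)
∈-allLists⁺ [] = here refl
∈-allLists⁺ (false ∷ l) = ∈-concatMap⁺ _ (lose (∈-allLists⁺ l) (here refl))
∈-allLists⁺ (true ∷ l) = ∈-concatMap⁺ _ (lose (∈-allLists⁺ l) (there (here refl)))

allLists-unique : ∀ n → Unique (allLists n)
allLists-unique zero = [] ∷ []
allLists-unique (suc n) = unique-concatMap _ (allLists n) (allLists-unique n)
  (λ l → ((λ ()) ∷ []) ∷ ([] ∷ [])) same-tail
  where
  same-tail : ∀ {l l' y} → y ∈ (false ∷ l) ∷ (true ∷ l) ∷ [] → y ∈ (false ∷ l') ∷ (true ∷ l') ∷ [] → l ≡ l'
  same-tail (here refl) (here refl) = refl
  same-tail (there (here refl)) (there (here refl)) = refl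
  same-tail (here refl) (there (here ()))
  same-tail (there (here refl)) (here ())
  same-tail _ (there (there ()))
  same-tail (there (there ())) _

norm-idem : ∀ p → norm (norm p) ≡ norm p
norm-idem p = ≐⇒≈ (norm-≐ p)

length-∷ʳtrue : ∀ l → length (l ++ [ true ]) ≡ suc (length l)
length-∷ʳtrue l = trans (ListP.length-++ l) (+-comm (length l) 1)

normalised-∷ʳtrue : ∀ l → Normalised (l ++ [ true ])
normalised-∷ʳtrue [] = refl
normalised-∷ʳtrue (false ∷ []) = refl
normalised-∷ʳtrue (true ∷ []) = refl
normalised-∷ʳtrue (a ∷ b ∷ l) rewrite normalised-∷ʳtrue (b ∷ l) with a
... | false = refl
... | true = refl

normalised⇒∷ʳtrue : ∀ D → Normalised D → D ≡ [] ⊎ ∃ λ l → D ≡ l ++ [ true ]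
normalised⇒∷ʳtrue [] e = inj₁ refl
normalised⇒∷ʳtrue (a ∷ D) e with norm D in eD
normalised⇒∷ʳtrue (false ∷ D) () | []
normalised⇒∷ʳtrue (true ∷ .[]) refl | [] = inj₂ ([] , refl)
normalised⇒∷ʳtrue (false ∷ D) refl | b ∷ r with normalised⇒∷ʳtrue D eD
... | inj₂ (l , D≡) = inj₂ (false ∷ l , cong (false ∷_) D≡)
normalised⇒∷ʳtrue (true ∷ D) refl | b ∷ r with normalised⇒∷ʳtrue D eD
... | inj₂ (l , D≡) = inj₂ (true ∷ l , cong (true ∷_) D≡)

monicBlock : ℕ → List Poly
monicBlock k = map (λ l → l ++ [ true ]) (allLists k)

∈-monicUpTo⁻ : ∀ d {D} → D ∈ monicUpTo d → Normalised D
∈-monicUpTo⁻ d m with k , _ , D∈ ← find (∈-concatMap⁻ monicBlock {xs = upTo (suc d)} m)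
                 with l , _ , refl ← ∈-map⁻ (λ l → l ++ [ true ]) D∈ = normalised-∷ʳtrue l

∈-monicUpTo⁺ : ∀ d D → Normalised D → NonZero D → len D ≤ suc d → D ∈ monicUpTo d
∈-monicUpTo⁺ d D nD nzD lD with normalised⇒∷ʳtrue D nD
... | inj₁ refl = ⊥-elim (nzD refl)
... | inj₂ (l , refl) = ∈-concatMap⁺ monicBlock (lose (∈-upTo⁺ l<) (∈-map⁺ (λ l → l ++ [ true ]) (∈-allLists⁺ l)))
  where
  l< : length l < suc d
  l< = subst (_≤ suc d) (trans (cong length (normalised-∷ʳtrue l)) (length-∷ʳtrue l)) lD

monicUpTo-unique : ∀ d → Unique (monicUpTo d)
monicUpTo-unique d = unique-concatMap monicBlock (upTo (suc d)) (UniqueP.upTo⁺ (suc d))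
  (λ k → UniqueP.map⁺ (ListP.∷ʳ-injectiveˡ _ _) (allLists-unique k)) same-length
  where
  length-of : ∀ {k y} → y ∈ monicBlock k → length y ≡ suc k
  length-of {k} m with l , l∈ , refl ← ∈-map⁻ (λ l → l ++ [ true ]) m = trans (length-∷ʳtrue l) (cong suc (∈-allLists⁻ k l∈))
  same-length : ∀ {k k' y} → y ∈ monicBlock k → y ∈ monicBlock k' → k ≡ k'
  same-length m m' = suc-injective (trans (sym (length-of m)) (length-of m'))

==ₚ⇒≈ : ∀ p q → (p ==ₚ q) ≡ true → p ≈ q
==ₚ⇒≈ p q e with ListP.≡-dec BoolP._≟_ (norm p) (norm q)
... | yes h = h

≈⇒==ₚ : ∀ p q → p ≈ q → (p ==ₚ q) ≡ true
≈⇒==ₚ p q e with ListP.≡-dec BoolP._≟_ (norm p) (norm q)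
... | yes h = refl
... | no h = ⊥-elim (h e)

nonZero-resp : ∀ {p q} → p ≐ q → NonZero p → NonZero q
nonZero-resp e nz h = nz (trans (≐⇒≈ e) h)

*ₚ-nonZero⁻ : ∀ Q D → NonZero (Q *ₚ D) → NonZero Q × NonZero D
*ₚ-nonZero⁻ Q D nz = (λ h → nz (≐⇒≈ (*ₚ-zeroˡ Q D (≈⇒≐ h))))
                    , (λ h → nz (≐⇒≈ (≐-trans (*ₚ-comm Q D) (*ₚ-zeroˡ D Q (≈⇒≐ h)))))

∣ₚ-nonZero : ∀ {X Y} → X ∣ₚ Y → NonZero Y → NonZero X
∣ₚ-nonZero (Q , e) nY = proj₂ (*ₚ-nonZero⁻ Q _ (nonZero-resp (≐-sym e) nY))

len-factors : ∀ Q D A → Q *ₚ D ≐ A → NonZero A → len D ≤ len A × len Q ≤ len A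
len-factors Q D A e nA with *ₚ-nonZero⁻ Q D (nonZero-resp (≐-sym e) nA)
... | nQ , nD with nonZero⇒len≡suc Q nQ | nonZero⇒len≡suc D nD
...   | a , ea | b , eb = subst (len D ≤_) lenA (subst (_≤ suc (a + b)) (sym eb) (s≤s (m≤n+m b a)))
                        , subst (len Q ≤_) lenA (subst (_≤ suc (a + b)) (sym ea) (s≤s (m≤m+n a b)))
  where
  lenA : suc (a + b) ≡ len A
  lenA = trans (sym (len-*ₚ Q D a b ea eb)) (len-cong e)

suc-deg : ∀ A → NonZero A → suc (deg A) ≡ len A
suc-deg A nA with a , e ← nonZero⇒len≡suc A nA rewrite e = refl

pad : ℕ → Poly → Poly
pad n Q = norm Q ++ replicate (n ∸ len Q) false

pad-≐ : ∀ n Q → pad n Q ≐ Q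
pad-≐ n Q = mk≐ λ i → trans (coeff-++zeros (norm Q) (n ∸ len Q) i) (coeff-norm Q i)
  where
  coeff-++zeros : ∀ r k i → coeff (r ++ replicate k false) i ≡ coeff r i
  coeff-++zeros [] zero i = refl
  coeff-++zeros [] (suc k) zero = refl
  coeff-++zeros [] (suc k) (suc i) = coeff-++zeros [] k i
  coeff-++zeros (a ∷ r) k zero = refl
  coeff-++zeros (a ∷ r) k (suc i) = coeff-++zeros r k i

length-pad : ∀ n Q → len Q ≤ n → length (pad n Q) ≡ n
length-pad n Q h = trans (ListP.length-++ (norm Q)) (trans (cong (len Q +_) (ListP.length-replicate (n ∸ len Q))) (m+[n∸m]≡n h))

divides?⇒∣ₚ : ∀ D A → divides? D A ≡ true → D ∣ₚ A
divides?⇒∣ₚ D A e with Q , _ , h ← any≡true⇒∃ (λ Q → (Q *ₚ D) ==ₚ A) (polysUpTo (deg A)) e =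
  Q , ≈⇒≐ (==ₚ⇒≈ (Q *ₚ D) A h)

∣ₚ⇒divides? : ∀ D A → NonZero A → D ∣ₚ A → divides? D A ≡ true
∣ₚ⇒divides? D A nA (Q , e) = ∈⇒any≡true (λ Q → (Q *ₚ D) ==ₚ A) Q'∈
  (≈⇒==ₚ (Q' *ₚ D) A (≐⇒≈ (≐-trans (*ₚ-congˡ D (pad-≐ (len A) Q)) e)))
  where
  Q' = pad (len A) Q
  length-Q' : length Q' ≡ suc (deg A)
  length-Q' = trans (length-pad (len A) Q (proj₂ (len-factors Q D A e nA))) (sym (suc-deg A nA))
  Q'∈ : Q' ∈ polysUpTo (deg A)
  Q'∈ = subst (λ n → Q' ∈ allLists n) length-Q' (∈-allLists⁺ Q')

∣ₚ? : ∀ S X → Dec (S ∣ₚ X)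
∣ₚ? S X with ListP.≡-dec BoolP._≟_ (norm X) []
... | yes X≈0 = yes ([] , ≈⇒≐ (sym X≈0))
... | no nX with divides? S X in e
...   | true = yes (divides?⇒∣ₚ S X e)
...   | false = no λ h → false≢true (trans (sym e) (∣ₚ⇒divides? S X nX h))
  where
  false≢true : ¬ (false ≡ true)
  false≢true ()

firstWith : (Poly → Bool) → List Poly → Poly
firstWith p [] = []
firstWith p (x ∷ xs) = if p x then x else firstWith p xs

firstWith-satisfies : ∀ p xs → any p xs ≡ true → p (firstWith p xs) ≡ true
firstWith-satisfies p (x ∷ xs) e with p x in ep
... | true = ep
... | false = firstWith-satisfies p xs e

-- Some Q with Q D ≈ A when D ∣ A ≠ 0, and an arbitrary polynomial otherwise.
infixl 7 _÷_
_÷_ : Poly → Poly → Poly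
A ÷ D = firstWith (λ Q → (Q *ₚ D) ==ₚ A) (polysUpTo (deg A))

÷-*ₚ : ∀ A D → NonZero A → D ∣ₚ A → (A ÷ D) *ₚ D ≐ A
÷-*ₚ A D nA dv = ≈⇒≐ (==ₚ⇒≈ (A ÷ D *ₚ D) A
  (firstWith-satisfies (λ Q → (Q *ₚ D) ==ₚ A) (polysUpTo (deg A)) (∣ₚ⇒divides? D A nA dv)))

∈-divisors⁻ : ∀ A {D} → D ∈ divisors A → Normalised D × D ∣ₚ A
∈-divisors⁻ A {D} m with D∈ , h ← ∈-filter⁻ (λ D → divides? D A BoolP.≟ true) {xs = monicUpTo (deg A)} m =
  ∈-monicUpTo⁻ (deg A) D∈ , divides?⇒∣ₚ D A h

∈-divisors⁺ : ∀ A {D} → NonZero A → Normalised D → D ∣ₚ A → D ∈ divisors A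
∈-divisors⁺ A {D} nA nD (Q , e) = ∈-filter⁺ (λ D → divides? D A BoolP.≟ true) {xs = monicUpTo (deg A)}
  (∈-monicUpTo⁺ (deg A) D nD (∣ₚ-nonZero (Q , e) nA) (subst (len D ≤_) (sym (suc-deg A nA)) (proj₁ (len-factors Q D A e nA))))
  (∣ₚ⇒divides? D A nA (Q , e))

divisors-unique : ∀ A → Unique (divisors A)
divisors-unique A = UniqueP.filter⁺ (λ D → divides? D A BoolP.≟ true) (monicUpTo-unique (deg A))

-- Irreducible factors and squarefree polynomials

len-cofactor< : ∀ Q R M → Q *ₚ R ≐ M → NonZero M → 2 ≤ len Q → len R < len M
len-cofactor< Q R M e nM lQ with *ₚ-nonZero⁻ Q R (nonZero-resp (≐-sym e) nM)
... | nQ , nR with nonZero⇒len≡suc Q nQ | nonZero⇒len≡suc R nR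
...   | suc a , ea | b , eb = subst₂ _<_ (sym eb) (trans (sym (len-*ₚ Q R (suc a) b ea eb)) (len-cong e)) (s≤s (s≤s (m≤n+m b a)))
...   | zero , ea | _ with s≤s () ← subst (2 ≤_) ea lQ

ProperDivisor : Poly → Poly → Set
ProperDivisor M D = 2 ≤ len D × len D < len M × D ∣ₚ M

properDivisor? : ∀ M → Decidable (ProperDivisor M)
properDivisor? M D = (2 ≤? len D) ×-dec (suc (len D) ≤? len M) ×-dec ∣ₚ? D M

norm-∈-monicUpTo : ∀ D M → NonZero M → len D ≤ len M → 2 ≤ len D → norm D ∈ monicUpTo (deg M)
norm-∈-monicUpTo D M nM lD l2 = ∈-monicUpTo⁺ (deg M) (norm D) (norm-idem D)
  (λ h → len≥2⇒nonZero D l2 (trans (sym (norm-idem D)) h))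
  (subst₂ _≤_ (sym (cong length (norm-idem D))) (sym (suc-deg M nM)) lD)

deg≢0⇒len≥2 : ∀ X → ¬ deg X ≡ 0 → 2 ≤ len X
deg≢0⇒len≥2 X d with len X
... | zero = ⊥-elim (d refl)
... | suc zero = ⊥-elim (d refl)
... | suc (suc _) = s≤s (s≤s z≤n)

noProperDivisor⇒irreducible : ∀ M → 2 ≤ len M → (∀ D → ¬ ProperDivisor M D) → Irreducible (norm M)
noProperDivisor⇒irreducible M l2 none =
  2≤len⇒1≤deg (norm M) (subst (2 ≤_) (sym (len-cong (norm-≐ M))) l2) , split
  where
  split : ∀ Q R → (Q *ₚ R) ≈ norm M → deg Q ≡ 0 ⊎ deg R ≡ 0
  split Q R e with deg Q ≟ 0 | deg R ≟ 0
  ... | yes dQ | _ = inj₁ dQ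
  ... | no _ | yes dR = inj₂ dR
  ... | no dQ | no dR = ⊥-elim (none R (deg≢0⇒len≥2 R dR , len-cofactor< Q R M QR≐M (len≥2⇒nonZero M l2) (deg≢0⇒len≥2 Q dQ) , Q , QR≐M))
    where
    QR≐M : Q *ₚ R ≐ M
    QR≐M = ≐-trans (≈⇒≐ e) (norm-≐ M)

irreducible-factor : ∀ M → 2 ≤ len M → ∃ λ P → Irreducible P × P ∣ₚ M
irreducible-factor M = search (len M) M ≤-refl
  where
  search : ∀ f M → len M ≤ f → 2 ≤ len M → ∃ λ P → Irreducible P × P ∣ₚ M
  search zero M lf l2 with () ← ≤-trans l2 lf
  search (suc f) M lf l2 with any? (properDivisor? M) (monicUpTo (deg M))
  ... | yes found with D , _ , (l2D , D<M , D∣M) ← find found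
                  with P , irr , P∣D ← search f D (≤-pred (≤-trans D<M lf)) l2D = P , irr , ∣ₚ-trans P∣D D∣M
  ... | no none = norm M , noProperDivisor⇒irreducible M l2 noneAtAll , ∣ₚ-resp (≐-sym (norm-≐ M)) ≐-refl (∣ₚ-refl M)
    where
    noneAtAll : ∀ D → ¬ ProperDivisor M D
    noneAtAll D (l2D , D<M , D∣M) = none (lose (norm-∈-monicUpTo D M (len≥2⇒nonZero M l2) (<⇒≤ D<M) l2D)
      (subst (2 ≤_) lenD l2D , subst (_< len M) lenD D<M , ∣ₚ-resp (≐-sym (norm-≐ D)) ≐-refl D∣M))
      where
      lenD : len D ≡ len (norm D)
      lenD = sym (len-cong (norm-≐ D))

squareFree-resp : ∀ {Q Q'} → Q ≐ Q' → SquareFree Q → SquareFree Q'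
squareFree-resp e sq P d dv = sq P d (∣ₚ⇒∣ (∣ₚ-resp ≐-refl (≐-sym e) (∣⇒∣ₚ dv)))

squareFree-∣ₚ : ∀ {X Y} → SquareFree X → Y ∣ₚ X → SquareFree Y
squareFree-∣ₚ sq dv P d dv' = sq P d (∣ₚ⇒∣ (∣ₚ-trans (∣⇒∣ₚ dv') dv))

squareFree-oneₚ : SquareFree oneₚ
squareFree-oneₚ P d dv with Q , e ← ∣⇒∣ₚ dv
  with s≤s () ← ≤-trans (1≤deg⇒2≤len P d)
         (≤-trans (proj₁ (len-factors P P (P *ₚ P) ≐-refl (∣ₚ-nonZero (Q , e) (λ ()))))
                  (proj₁ (len-factors Q (P *ₚ P) oneₚ e (λ ()))))

squareFree⇒nonZero : ∀ Q → SquareFree Q → NonZero Q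
squareFree⇒nonZero Q sq Q≈0 = sq x (s≤s z≤n) ([] , sym Q≈0)
  where
  x = false ∷ true ∷ []

irreducibleSquareFree⇒squareFree : ∀ F → (∀ S → Irreducible S → ¬ (S *ₚ S ∣ₚ F)) → SquareFree F
irreducibleSquareFree⇒squareFree F h P d dv with S , irrS , (k , ek) ← irreducible-factor P (1≤deg⇒2≤len P d) =
  h S irrS (∣ₚ-trans (k *ₚ k , ≐-trans (regroup k S) (*ₚ-cong ek ek)) (∣⇒∣ₚ dv))
  where
  regroup : ∀ k s → (k *ₚ k) *ₚ (s *ₚ s) ≐ (k *ₚ s) *ₚ (k *ₚ s)
  regroup = solve-∀ poly-ring

squareFree-*ₚ-irreducible : ∀ F P → SquareFree F → Irreducible P → ¬ (P ∣ₚ F) → SquareFree (F *ₚ P)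
squareFree-*ₚ-irreducible F P sq irrP P∤F = irreducibleSquareFree⇒squareFree (F *ₚ P) noSquare
  where
  nP = irreducible⇒nonZero P irrP
  noSquare : ∀ S → Irreducible S → ¬ (S *ₚ S ∣ₚ F *ₚ P)
  noSquare S irrS SS∣FP with ∣ₚ? S F
  ... | no S∤F = P∤F (∣ₚ-cancelˡ P P F nP (∣ₚ-resp (*ₚ-cong S≐P S≐P) (*ₚ-comm F P) SS∣FP))
    where
    S≐P : S ≐ P
    S≐P = irreducible-divisor P S irrP (irreducible-prime S F P irrS (∣ₚ-trans (∣ₚ-*ₚʳ S S) SS∣FP) S∤F) (irreducible⇒len≥2 S irrS)
  ... | yes (F₁ , F₁S≐F) with ∣ₚ? S F₁
  ...   | yes (k , kS≐F₁) = sq S (proj₁ irrS) (∣ₚ⇒∣ (k , ≐-trans (reassoc k S) (≐-trans (*ₚ-congˡ S kS≐F₁) F₁S≐F)))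
    where
    reassoc : ∀ k s → k *ₚ (s *ₚ s) ≐ (k *ₚ s) *ₚ s
    reassoc = solve-∀ poly-ring
  ...   | no S∤F₁ = P∤F (∣ₚ-resp S≐P ≐-refl (F₁ , F₁S≐F))
    where
    reassoc : ∀ f s p → (f *ₚ s) *ₚ p ≐ s *ₚ (f *ₚ p)
    reassoc = solve-∀ poly-ring
    S∣F₁P : S ∣ₚ F₁ *ₚ P
    S∣F₁P = ∣ₚ-cancelˡ S S (F₁ *ₚ P) (irreducible⇒nonZero S irrS)
      (∣ₚ-resp ≐-refl (≐-trans (*ₚ-congˡ P (≐-sym F₁S≐F)) (reassoc F₁ S P)) SS∣FP)
    S≐P : S ≐ P
    S≐P = irreducible-divisor P S irrP (irreducible-prime S F₁ P irrS S∣F₁P S∤F₁) (irreducible⇒len≥2 S irrS)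

nonZero? : Decidable NonZero
nonZero? Q = ¬? (ListP.≡-dec BoolP._≟_ (norm Q) [])

SquareDivisor : Poly → Poly → Set
SquareDivisor Q P = 2 ≤ len P × P *ₚ P ∣ₚ Q

squareDivisor? : ∀ Q → Decidable (SquareDivisor Q)
squareDivisor? Q P = (2 ≤? len P) ×-dec ∣ₚ? (P *ₚ P) Q

squareFree? : Decidable SquareFree
squareFree? Q with nonZero? Q
... | no ¬nQ = no λ sq → ¬nQ (squareFree⇒nonZero Q sq)
... | yes nQ with any? (squareDivisor? Q) (monicUpTo (deg Q))
...   | yes found with P , _ , (l2 , PP∣Q) ← find found = no λ sq → sq P (2≤len⇒1≤deg P l2) (∣ₚ⇒∣ PP∣Q)
...   | no none = yes noSquare
  where
  noSquare : SquareFree Q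
  noSquare P d PP∣Q = none (lose (norm-∈-monicUpTo P Q nQ P≤Q l2) (subst (2 ≤_) lenP l2 , ∣ₚ-resp (*ₚ-cong P≐ P≐) ≐-refl (∣⇒∣ₚ PP∣Q)))
    where
    l2 = 1≤deg⇒2≤len P d
    nP = len≥2⇒nonZero P l2
    P≐ = ≐-sym (norm-≐ P)
    lenP : len P ≡ len (norm P)
    lenP = sym (len-cong (norm-≐ P))
    P≤Q : len P ≤ len Q
    P≤Q with Q' , e ← ∣⇒∣ₚ PP∣Q = ≤-trans (proj₁ (len-factors P P (P *ₚ P) ≐-refl (*ₚ-nonZero P P nP nP)))
                                          (proj₁ (len-factors Q' (P *ₚ P) Q e nQ))

-- Finite sums

sumₚ : (Poly → Poly) → List Poly → Poly
sumₚ f = foldr (λ x s → f x +ₚ s) []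

sumₚ-cong : ∀ {f g} xs → (∀ {x} → x ∈ xs → f x ≐ g x) → sumₚ f xs ≐ sumₚ g xs
sumₚ-cong [] h = ≐-refl
sumₚ-cong (x ∷ xs) h = +ₚ-cong (h (here refl)) (sumₚ-cong xs (h ∘ there))

sumₚ-↭ : ∀ f {xs ys} → xs ↭ ys → sumₚ f xs ≐ sumₚ f ys
sumₚ-↭ f Perm.refl = ≐-refl
sumₚ-↭ f (Perm.prep x p) = +ₚ-cong ≐-refl (sumₚ-↭ f p)
sumₚ-↭ f (Perm.swap x y p) = ≐-trans (≐-sym (+ₚ-assoc (f x) (f y) _))
  (≐-trans (+ₚ-cong (+ₚ-comm (f x) (f y)) (sumₚ-↭ f p)) (+ₚ-assoc (f y) (f x) _))
sumₚ-↭ f (Perm.trans p q) = ≐-trans (sumₚ-↭ f p) (sumₚ-↭ f q)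

sameElements⇒↭ : ∀ {xs ys : List Poly} → Unique xs → Unique ys →
  (∀ {x} → x ∈ xs → x ∈ ys) → (∀ {x} → x ∈ ys → x ∈ xs) → xs ↭ ys
sameElements⇒↭ ux uy f g = ∼bag⇒↭ (unique∧set⇒bag ux uy (mk⇔ f g))

sumₚ-map : ∀ f φ xs → sumₚ f (map φ xs) ≡ sumₚ (f ∘ φ) xs
sumₚ-map f φ [] = refl
sumₚ-map f φ (x ∷ xs) = cong (f (φ x) +ₚ_) (sumₚ-map f φ xs)

unique-map : ∀ (φ : Poly → Poly) {xs} → Unique xs →
  (∀ {x x'} → x ∈ xs → x' ∈ xs → φ x ≡ φ x' → x ≡ x') → Unique (map φ xs)
unique-map φ {[]} u inj = []
unique-map φ {x ∷ xs} (x∉xs ∷ u) inj = All.tabulate fresh ∷ unique-map φ u (λ m m' → inj (there m) (there m'))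
  where
  fresh : ∀ {y} → y ∈ map φ xs → ¬ φ x ≡ y
  fresh m e with z , z∈xs , refl ← ∈-map⁻ φ m = All.lookup x∉xs z∈xs (inj (here refl) (there z∈xs) e)

sumₚ-reindex : ∀ (f φ : Poly → Poly) {xs ys} → Unique xs → Unique ys →
  (∀ {x} → x ∈ xs → φ x ∈ ys) →
  (∀ {x x'} → x ∈ xs → x' ∈ xs → φ x ≡ φ x' → x ≡ x') →
  (∀ {y} → y ∈ ys → ∃ λ x → x ∈ xs × φ x ≡ y) →
  sumₚ f ys ≐ sumₚ (f ∘ φ) xs
sumₚ-reindex f φ {xs} {ys} ux uy into inj onto =
  ≐-trans (sumₚ-↭ f (sameElements⇒↭ uy (unique-map φ ux inj) image⁺ image⁻))
          (≈⇒≐ (cong norm (sumₚ-map f φ xs)))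
  where
  image⁺ : ∀ {y} → y ∈ ys → y ∈ map φ xs
  image⁺ m with x , x∈xs , refl ← onto m = ∈-map⁺ φ x∈xs
  image⁻ : ∀ {y} → y ∈ map φ xs → y ∈ ys
  image⁻ m with x , x∈xs , refl ← ∈-map⁻ φ m = into x∈xs

sumₚ-filter : ∀ f {ℓ} {P : Pred Poly ℓ} (P? : Decidable P) xs →
  sumₚ f (filter P? xs) ≐ sumₚ (λ x → if does (P? x) then f x else []) xs
sumₚ-filter f P? [] = ≐-refl
sumₚ-filter f P? (x ∷ xs) with does (P? x)
... | true = +ₚ-cong ≐-refl (sumₚ-filter f P? xs)
... | false = sumₚ-filter f P? xs

sumₚ-partition : ∀ f {ℓ} {P : Pred Poly ℓ} (P? : Decidable P) xs →
  sumₚ f xs ≐ sumₚ f (filter P? xs) +ₚ sumₚ f (filter (∁? P?) xs)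
sumₚ-partition f P? [] = ≐-refl
sumₚ-partition f P? (x ∷ xs) with does (P? x)
... | true = ≐-trans (+ₚ-cong ≐-refl (sumₚ-partition f P? xs)) (≐-sym (+ₚ-assoc (f x) (sumₚ f (filter P? xs)) (sumₚ f (filter (∁? P?) xs))))
... | false = ≐-trans (+ₚ-cong ≐-refl (sumₚ-partition f P? xs)) (swap-front (f x) (sumₚ f (filter P? xs)) (sumₚ f (filter (∁? P?) xs)))
  where
  swap-front : ∀ a b c → a +ₚ (b +ₚ c) ≐ b +ₚ (a +ₚ c)
  swap-front = solve-∀ poly-ring

sumₚ-+ₚ : ∀ f g xs → sumₚ (λ x → f x +ₚ g x) xs ≐ sumₚ f xs +ₚ sumₚ g xs
sumₚ-+ₚ f g [] = ≐-refl
sumₚ-+ₚ f g (x ∷ xs) = ≐-trans (+ₚ-cong ≐-refl (sumₚ-+ₚ f g xs)) (regroup (f x) (g x) (sumₚ f xs) (sumₚ g xs))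
  where
  regroup : ∀ a b c d → (a +ₚ b) +ₚ (c +ₚ d) ≐ (a +ₚ c) +ₚ (b +ₚ d)
  regroup = solve-∀ poly-ring

sumₚ-zero : ∀ xs → sumₚ (λ _ → []) xs ≐ []
sumₚ-zero [] = ≐-refl
sumₚ-zero (x ∷ xs) = sumₚ-zero xs

sumₚ-swap : ∀ (g : Poly → Poly → Poly) xs ys →
  sumₚ (λ x → sumₚ (g x) ys) xs ≐ sumₚ (λ y → sumₚ (λ x → g x y) xs) ys
sumₚ-swap g [] ys = ≐-sym (sumₚ-zero ys)
sumₚ-swap g (x ∷ xs) ys = ≐-trans (+ₚ-cong ≐-refl (sumₚ-swap g xs ys)) (≐-sym (sumₚ-+ₚ (g x) _ ys))

sumₚ-*ₚʳ : ∀ f xs c → sumₚ f xs *ₚ c ≐ sumₚ (λ x → f x *ₚ c) xs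
sumₚ-*ₚʳ f [] c = ≐-refl
sumₚ-*ₚʳ f (x ∷ xs) c = ≐-trans (*ₚ-distribʳ (f x) (sumₚ f xs) c) (+ₚ-cong ≐-refl (sumₚ-*ₚʳ f xs c))

sumₚ-singleton : ∀ f {xs} c → Unique xs → c ∈ xs → (∀ {x} → x ∈ xs → x ≡ c) → sumₚ f xs ≐ f c
sumₚ-singleton f c u c∈xs only =
  ≐-trans (sumₚ-↭ f (sameElements⇒↭ u ([] ∷ []) (λ m → here (only m)) λ { (here refl) → c∈xs })) (+ₚ-identityʳ (f c))

-- σ and squarefree divisors

normalised-≡ : ∀ {p q} → Normalised p → Normalised q → p ≐ q → p ≡ q
normalised-≡ np nq e = trans (sym np) (trans (≐⇒≈ e) nq)

σ-resp : ∀ {A A'} → NonZero A → A ≐ A' → σ A ≐ σ A'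
σ-resp {A} {A'} nA e = sumₚ-↭ id (sameElements⇒↭ (divisors-unique A) (divisors-unique A') (transport e nA) (transport (≐-sym e) (nonZero-resp e nA)))
  where
  transport : ∀ {A A'} → A ≐ A' → NonZero A → ∀ {D} → D ∈ divisors A → D ∈ divisors A'
  transport {A} {A'} e nA m with nD , D∣A ← ∈-divisors⁻ A m = ∈-divisors⁺ A' (nonZero-resp e nA) nD (∣ₚ-resp ≐-refl e D∣A)

σ-÷-*ₚ : ∀ A F → NonZero A → F ∣ₚ A → σ (A ÷ F) *ₚ F ≐ sumₚ id (filter (∣ₚ? F) (divisors A))
σ-÷-*ₚ A F nA F∣A =
  ≐-trans (sumₚ-*ₚʳ id (divisors K) F)
  (≐-trans (≐-sym (sumₚ-cong (divisors K) (λ {G} _ → norm-≐ (G *ₚ F))))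
  (≐-sym (sumₚ-reindex id ψ (divisors-unique K) (UniqueP.filter⁺ (∣ₚ? F) (divisors-unique A)) into inj onto)))
  where
  K = A ÷ F
  KF≐A : K *ₚ F ≐ A
  KF≐A = ÷-*ₚ A F nA F∣A
  nK : NonZero K
  nK = proj₁ (*ₚ-nonZero⁻ K F (nonZero-resp (≐-sym KF≐A) nA))
  nF : NonZero F
  nF = ∣ₚ-nonZero F∣A nA
  ψ : Poly → Poly
  ψ G = norm (G *ₚ F)
  into : ∀ {G} → G ∈ divisors K → ψ G ∈ filter (∣ₚ? F) (divisors A)
  into {G} m with _ , (H , HG≐K) ← ∈-divisors⁻ K m =
    ∈-filter⁺ (∣ₚ? F) (∈-divisors⁺ A nA (norm-idem (G *ₚ F)) ψG∣A) (G , ≐-sym (norm-≐ (G *ₚ F)))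
    where
    reassoc : ∀ h g f → h *ₚ (g *ₚ f) ≐ (h *ₚ g) *ₚ f
    reassoc = solve-∀ poly-ring
    ψG∣A : ψ G ∣ₚ A
    ψG∣A = H , ≐-trans (*ₚ-congʳ H (norm-≐ (G *ₚ F))) (≐-trans (reassoc H G F) (≐-trans (*ₚ-congˡ F HG≐K) KF≐A))
  inj : ∀ {G G'} → G ∈ divisors K → G' ∈ divisors K → ψ G ≡ ψ G' → G ≡ G'
  inj m m' e = normalised-≡ (proj₁ (∈-divisors⁻ K m)) (proj₁ (∈-divisors⁻ K m')) (*ₚ-cancelʳ _ _ F nF (≈⇒≐ e))
  onto : ∀ {E} → E ∈ filter (∣ₚ? F) (divisors A) → ∃ λ G → G ∈ divisors K × ψ G ≡ E
  onto {E} m with E∈ , (q , qF≐E) ← ∈-filter⁻ (∣ₚ? F) m with nE , (R , RE≐A) ← ∈-divisors⁻ A E∈ =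
    norm q , ∈-divisors⁺ K nK (norm-idem q) (R , ≐-trans (*ₚ-congʳ R (norm-≐ q)) Rq≐K) ,
    normalised-≡ (norm-idem (norm q *ₚ F)) nE (≐-trans (norm-≐ (norm q *ₚ F)) (≐-trans (*ₚ-congˡ F (norm-≐ q)) qF≐E))
    where
    Rq≐K : R *ₚ q ≐ K
    Rq≐K = *ₚ-cancelʳ (R *ₚ q) K F nF
      (≐-trans (*ₚ-assoc R q F) (≐-trans (*ₚ-congʳ R qF≐E) (≐-trans RE≐A (≐-sym KF≐A))))

_≈?_ : ∀ p q → Dec (p ≈ q)
p ≈? q = ListP.≡-dec BoolP._≟_ (norm p) (norm q)

∣ₚ-oneₚ : ∀ F → Normalised F → F ∣ₚ oneₚ → F ≡ oneₚ
∣ₚ-oneₚ F nF (Q , e) with len-factors Q F oneₚ e (λ ()) | ∣ₚ-nonZero (Q , e) (λ ())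
... | F≤1 , _ | nzF with len≤1⇒constant F F≤1
...   | inj₁ F≐0 = ⊥-elim (nzF (≐⇒≈ F≐0))
...   | inj₂ F≐1 = normalised-≡ nF refl F≐1

≉oneₚ⇒len≥2 : ∀ E → NonZero E → ¬ (E ≈ oneₚ) → 2 ≤ len E
≉oneₚ⇒len≥2 E nE E≉1 with nonZero⇒len≡suc E nE
... | zero , e = ⊥-elim (E≉1 (≐⇒≈ (len≡1⇒≐oneₚ E e)))
... | suc k , e rewrite e = s≤s (s≤s z≤n)

module SquareFreeDivisors (E : Poly) {T : List Poly} (uT : Unique T)
  (∈T⁻ : ∀ {F} → F ∈ T → Normalised F × SquareFree F × F ∣ₚ E)
  (∈T⁺ : ∀ {F} → Normalised F → SquareFree F → F ∣ₚ E → F ∈ T) where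

  -- F ↦ F P pairs the members not divisible by P with those divisible by P.
  sum-even : ∀ X P → Irreducible P → P ∣ₚ E → sumₚ (λ _ → X) T ≐ []
  sum-even X P irrP P∣E =
    ≐-trans (sumₚ-partition (λ _ → X) (∣ₚ? P) T)
    (≐-trans (+ₚ-cong (sumₚ-reindex (λ _ → X) χ (UniqueP.filter⁺ (∁? (∣ₚ? P)) uT) (UniqueP.filter⁺ (∣ₚ? P) uT) into inj onto) ≐-refl)
    (+ₚ-self (sumₚ (λ _ → X) (filter (∁? (∣ₚ? P)) T))))
    where
    nP = irreducible⇒nonZero P irrP
    χ : Poly → Poly
    χ F = norm (F *ₚ P)
    into : ∀ {F} → F ∈ filter (∁? (∣ₚ? P)) T → χ F ∈ filter (∣ₚ? P) T
    into {F} m with F∈T , P∤F ← ∈-filter⁻ (∁? (∣ₚ? P)) m with nF , sqF , (G , GF≐E) ← ∈T⁻ F∈T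
                 with H , HP≐G ← irreducible-prime P F G irrP (∣ₚ-resp ≐-refl (≐-trans (≐-sym GF≐E) (*ₚ-comm G F)) P∣E) P∤F =
      ∈-filter⁺ (∣ₚ? P) (∈T⁺ (norm-idem (F *ₚ P)) sq χF∣E) (F , ≐-sym (norm-≐ (F *ₚ P)))
      where
      reassoc : ∀ h f p → h *ₚ (f *ₚ p) ≐ (h *ₚ p) *ₚ f
      reassoc = solve-∀ poly-ring
      sq : SquareFree (χ F)
      sq = squareFree-resp (≐-sym (norm-≐ (F *ₚ P))) (squareFree-*ₚ-irreducible F P sqF irrP P∤F)
      χF∣E : χ F ∣ₚ E
      χF∣E = H , ≐-trans (*ₚ-congʳ H (norm-≐ (F *ₚ P))) (≐-trans (reassoc H F P) (≐-trans (*ₚ-congˡ F HP≐G) GF≐E))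
    inj : ∀ {F F'} → F ∈ filter (∁? (∣ₚ? P)) T → F' ∈ filter (∁? (∣ₚ? P)) T → χ F ≡ χ F' → F ≡ F'
    inj m m' e = normalised-≡ (proj₁ (∈T⁻ (proj₁ (∈-filter⁻ (∁? (∣ₚ? P)) m)))) (proj₁ (∈T⁻ (proj₁ (∈-filter⁻ (∁? (∣ₚ? P)) m'))))
      (*ₚ-cancelʳ _ _ P nP (≈⇒≐ e))
    onto : ∀ {y} → y ∈ filter (∣ₚ? P) T → ∃ λ x → x ∈ filter (∁? (∣ₚ? P)) T × χ x ≡ y
    onto {y} m with y∈T , (Q , QP≐y) ← ∈-filter⁻ (∣ₚ? P) m with ny , sqy , y∣E ← ∈T⁻ y∈T =
      norm Q , ∈-filter⁺ (∁? (∣ₚ? P)) (∈T⁺ (norm-idem Q) (squareFree-∣ₚ sqy Q'∣y) (∣ₚ-trans Q'∣y y∣E)) P∤Q' ,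
      normalised-≡ (norm-idem (norm Q *ₚ P)) ny (≐-trans (norm-≐ (norm Q *ₚ P)) (≐-trans (*ₚ-congˡ P (norm-≐ Q)) QP≐y))
      where
      Q'∣y : norm Q ∣ₚ y
      Q'∣y = P , ≐-trans (*ₚ-congʳ P (norm-≐ Q)) (≐-trans (*ₚ-comm P Q) QP≐y)
      reassoc : ∀ k p → k *ₚ (p *ₚ p) ≐ (k *ₚ p) *ₚ p
      reassoc = solve-∀ poly-ring
      P∤Q' : ¬ (P ∣ₚ norm Q)
      P∤Q' (k , kP≐Q') = sqy P (proj₁ irrP) (∣ₚ⇒∣ (k , ≐-trans (reassoc k P)
        (≐-trans (*ₚ-congˡ P (≐-trans kP≐Q' (norm-≐ Q))) QP≐y)))

  sum-parity : ∀ X → NonZero E → sumₚ (λ _ → X) T ≐ (if does (E ≈? oneₚ) then X else [])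
  sum-parity X nE with E ≈? oneₚ
  ... | yes E≈1 = sumₚ-singleton (λ _ → X) oneₚ uT
    (∈T⁺ refl squareFree-oneₚ (∣ₚ-resp ≐-refl (≈⇒≐ (sym E≈1)) (∣ₚ-refl oneₚ)))
    (λ m → let nF , _ , F∣E = ∈T⁻ m in ∣ₚ-oneₚ _ nF (∣ₚ-resp ≐-refl (≈⇒≐ E≈1) F∣E))
  ... | no E≉1 with P , irrP , P∣E ← irreducible-factor E (≉oneₚ⇒len≥2 E nE E≉1) = sum-even X P irrP P∣E

squareFreeDivisors : Poly → List Poly
squareFreeDivisors A = filter squareFree? (divisors A)

∈-squareFreeDivisors⁻ : ∀ A {F} → F ∈ squareFreeDivisors A → Normalised F × F ∣ₚ A × SquareFree F
∈-squareFreeDivisors⁻ A m with F∈ , sqF ← ∈-filter⁻ squareFree? m with nF , F∣A ← ∈-divisors⁻ A F∈ = nF , F∣A , sqF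

∈-squareFreeDivisors⁺ : ∀ A {F} → NonZero A → Normalised F → F ∣ₚ A → SquareFree F → F ∈ squareFreeDivisors A
∈-squareFreeDivisors⁺ A nA nF F∣A sqF = ∈-filter⁺ squareFree? (∈-divisors⁺ A nA nF F∣A) sqF

squareFreeDivisors-unique : ∀ A → Unique (squareFreeDivisors A)
squareFreeDivisors-unique A = UniqueP.filter⁺ squareFree? (divisors-unique A)

sumₚ-σ-squareFreeDivisors : ∀ A → NonZero A → sumₚ (λ F → σ (A ÷ F) *ₚ F) (squareFreeDivisors A) ≐ oneₚ
sumₚ-σ-squareFreeDivisors A nA = begin
  sumₚ (λ F → σ (A ÷ F) *ₚ F) SQ
    ≈⟨ sumₚ-cong SQ (λ m → σ-÷-*ₚ A _ nA (proj₁ (proj₂ (∈-squareFreeDivisors⁻ A m)))) ⟩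
  sumₚ (λ F → sumₚ id (filter (∣ₚ? F) Ds)) SQ
    ≈⟨ sumₚ-cong SQ (λ {F} _ → sumₚ-filter id (∣ₚ? F) Ds) ⟩
  sumₚ (λ F → sumₚ (λ E → [ F ∣ E ]· E) Ds) SQ
    ≈⟨ sumₚ-swap (λ F E → [ F ∣ E ]· E) SQ Ds ⟩
  sumₚ (λ E → sumₚ (λ F → [ F ∣ E ]· E) SQ) Ds
    ≈⟨ sumₚ-cong Ds (λ {E} _ → ≐-sym (sumₚ-filter (λ _ → E) (λ F → ∣ₚ? F E) SQ)) ⟩
  sumₚ (λ E → sumₚ (λ _ → E) (filter (λ F → ∣ₚ? F E) SQ)) Ds
    ≈⟨ sumₚ-cong Ds parity ⟩
  sumₚ (λ E → if does (E ≈? oneₚ) then E else []) Ds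
    ≈⟨ sumₚ-filter id (_≈? oneₚ) Ds ⟨
  sumₚ id (filter (_≈? oneₚ) Ds)
    ≈⟨ sumₚ-singleton id oneₚ (UniqueP.filter⁺ (_≈? oneₚ) (divisors-unique A))
         (∈-filter⁺ (_≈? oneₚ) (∈-divisors⁺ A nA refl (A , *ₚ-identityʳ A)) refl) only-one ⟩
  oneₚ ∎
  where
  open ≐-Reasoning
  SQ = squareFreeDivisors A
  Ds = divisors A
  [_∣_]·_ : Poly → Poly → Poly → Poly
  [ F ∣ E ]· X = if does (∣ₚ? F E) then X else []
  parity : ∀ {E} → E ∈ Ds → sumₚ (λ _ → E) (filter (λ F → ∣ₚ? F E) SQ) ≐ (if does (E ≈? oneₚ) then E else [])
  parity {E} E∈ with _ , E∣A ← ∈-divisors⁻ A E∈ =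
    SquareFreeDivisors.sum-parity E (UniqueP.filter⁺ (λ F → ∣ₚ? F E) (squareFreeDivisors-unique A))
      (λ m → let F∈ , F∣E = ∈-filter⁻ (λ F → ∣ₚ? F E) m ; nF , _ , sqF = ∈-squareFreeDivisors⁻ A F∈ in nF , sqF , F∣E)
      (λ nF sqF F∣E → ∈-filter⁺ (λ F → ∣ₚ? F E) (∈-squareFreeDivisors⁺ A nA nF (∣ₚ-trans F∣E E∣A) sqF) F∣E)
      E (∣ₚ-nonZero E∣A nA)
  only-one : ∀ {E} → E ∈ filter (_≈? oneₚ) Ds → E ≡ oneₚ
  only-one m with E∈ , E≈1 ← ∈-filter⁻ (_≈? oneₚ) m = normalised-≡ (proj₁ (∈-divisors⁻ A E∈)) refl (≈⇒≐ E≈1)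

÷-cofactor : ∀ A D Q → NonZero A → Q *ₚ D ≐ A → A ÷ D ≐ Q
÷-cofactor A D Q nA QD≐A = *ₚ-cancelʳ (A ÷ D) Q D (∣ₚ-nonZero (Q , QD≐A) nA) (≐-trans (÷-*ₚ A D nA (Q , QD≐A)) (≐-sym QD≐A))

SquareFreeCofactor : Poly → Poly → Set
SquareFreeCofactor A D = ∃ λ Q → Q *ₚ D ≐ A × SquareFree Q

-- F ↦ A ÷ F maps the squarefree divisors of A bijectively onto L.
sumₚ-σ-squareFreeCofactors : ∀ A → NonZero A → ∀ {L} → Unique L →
  (∀ {D} → D ∈ L → Normalised D × SquareFreeCofactor A D) →
  (∀ {D} → Normalised D → SquareFreeCofactor A D → D ∈ L) →
  sumₚ (λ D → σ D *ₚ (A ÷ D)) L ≐ oneₚ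
sumₚ-σ-squareFreeCofactors A nA {L} uL ∈L⁻ ∈L⁺ =
  ≐-trans (sumₚ-reindex (λ D → σ D *ₚ (A ÷ D)) φ (squareFreeDivisors-unique A) uL into inj onto)
  (≐-trans (sumₚ-cong (squareFreeDivisors A) pointwise) (sumₚ-σ-squareFreeDivisors A nA))
  where
  φ : Poly → Poly
  φ F = norm (A ÷ F)
  Fφ≐A : ∀ {F} → F ∣ₚ A → F *ₚ φ F ≐ A
  Fφ≐A {F} F∣A = ≐-trans (*ₚ-congʳ F (norm-≐ (A ÷ F))) (≐-trans (*ₚ-comm F (A ÷ F)) (÷-*ₚ A F nA F∣A))
  into : ∀ {F} → F ∈ squareFreeDivisors A → φ F ∈ L
  into {F} m with _ , F∣A , sqF ← ∈-squareFreeDivisors⁻ A m = ∈L⁺ (norm-idem (A ÷ F)) (F , Fφ≐A F∣A , sqF)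
  inj : ∀ {F F'} → F ∈ squareFreeDivisors A → F' ∈ squareFreeDivisors A → φ F ≡ φ F' → F ≡ F'
  inj {F} {F'} m m' e with nF , F∣A , _ ← ∈-squareFreeDivisors⁻ A m | nF' , F'∣A , _ ← ∈-squareFreeDivisors⁻ A m' =
    normalised-≡ nF nF' (*ₚ-cancelʳ F F' (φ F) (∣ₚ-nonZero (F , Fφ≐A F∣A) nA)
      (≐-trans (Fφ≐A F∣A) (≐-sym (≐-trans (*ₚ-congʳ F' (≈⇒≐ (cong norm e))) (Fφ≐A F'∣A)))))
  onto : ∀ {D} → D ∈ L → ∃ λ F → F ∈ squareFreeDivisors A × φ F ≡ D
  onto {D} m with nD , Q , QD≐A , sqQ ← ∈L⁻ m =
    norm Q , ∈-squareFreeDivisors⁺ A nA (norm-idem Q) Q'∣A (squareFree-resp (≐-sym (norm-≐ Q)) sqQ) ,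
    normalised-≡ (norm-idem (A ÷ norm Q)) nD (≐-trans (norm-≐ (A ÷ norm Q)) (÷-cofactor A (norm Q) D nA DQ'≐A))
    where
    DQ'≐A : D *ₚ norm Q ≐ A
    DQ'≐A = ≐-trans (*ₚ-congʳ D (norm-≐ Q)) (≐-trans (*ₚ-comm D Q) QD≐A)
    Q'∣A : norm Q ∣ₚ A
    Q'∣A = D , DQ'≐A
  pointwise : ∀ {F} → F ∈ squareFreeDivisors A → σ (φ F) *ₚ (A ÷ φ F) ≐ σ (A ÷ F) *ₚ F
  pointwise {F} m with _ , F∣A , _ ← ∈-squareFreeDivisors⁻ A m =
    *ₚ-cong (σ-resp (∣ₚ-nonZero (F , Fφ≐A F∣A) nA) (norm-≐ (A ÷ F)))
            (÷-cofactor A (φ F) F nA (Fφ≐A F∣A))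

sumF-over-divisors : ∀ A (g : Poly → Poly) Ds → (∀ {D} → D ∈ Ds → (A ÷ D) *ₚ D ≐ A) →
  let (n , d) = sumF (map (λ D → (g D , D)) Ds) in n *ₚ A ≐ d *ₚ sumₚ (λ D → g D *ₚ (A ÷ D)) Ds
sumF-over-divisors A g [] _ = ≐-sym (*ₚ-identityˡ [])
sumF-over-divisors A g (D ∷ Ds) ÷D with sumF (map (λ D → (g D , D)) Ds) | sumF-over-divisors A g Ds (÷D ∘ there)
... | n , d | nA≐dS = ≐-trans (distrib (g D) d n D A)
  (≐-trans (+ₚ-cong (*ₚ-congʳ (g D *ₚ d) (≐-sym (÷D (here refl)))) (*ₚ-congˡ D nA≐dS))
  (collect (g D) d D (A ÷ D) (sumₚ (λ D → g D *ₚ (A ÷ D)) Ds)))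
  where
  distrib : ∀ s d n x a → (s *ₚ d +ₚ n *ₚ x) *ₚ a ≐ (s *ₚ d) *ₚ a +ₚ (n *ₚ a) *ₚ x
  distrib = solve-∀ poly-ring
  collect : ∀ s d x q t → (s *ₚ d) *ₚ (q *ₚ x) +ₚ (d *ₚ t) *ₚ x ≐ (x *ₚ d) *ₚ (s *ₚ q +ₚ t)
  collect = solve-∀ poly-ring

-- L = A ∷ Ds lists the divisors with squarefree cofactor, and the term of A is σ(A) = A.
sumₚ-σ-properSquareFreeCofactors : ∀ A → NonZero A → Perfect A → ∀ {Ds} → Unique Ds →
  (∀ {D} → D ∈ Ds → Normalised D × ¬ (D ≈ A) × SquareFreeCofactor A D) →
  (∀ {D} → Normalised D → ¬ (D ≈ A) → SquareFreeCofactor A D → D ∈ Ds) →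
  sumₚ (λ D → σ D *ₚ (A ÷ D)) Ds ≐ A +ₚ oneₚ
sumₚ-σ-properSquareFreeCofactors A nA perfect {Ds} uDs ∈Ds⁻ ∈Ds⁺ =
  ≐-trans (+ₚ-moveˡ (σ A₀ *ₚ (A ÷ A₀)) _ oneₚ (sumₚ-σ-squareFreeCofactors A nA uL ∈L⁻ ∈L⁺))
          (≐-trans (+ₚ-cong ≐-refl A₀-term) (+ₚ-comm oneₚ A))
  where
  A₀ = norm A
  A₀≐A : oneₚ *ₚ A₀ ≐ A
  A₀≐A = ≐-trans (*ₚ-identityˡ A₀) (norm-≐ A)
  L = A₀ ∷ Ds
  uL : Unique L
  uL = All.tabulate (λ m A₀≡D → proj₁ (proj₂ (∈Ds⁻ m)) (subst (_≈ A) A₀≡D (norm-idem A))) ∷ uDs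
  ∈L⁻ : ∀ {D} → D ∈ L → Normalised D × SquareFreeCofactor A D
  ∈L⁻ (here refl) = norm-idem A , oneₚ , A₀≐A , squareFree-oneₚ
  ∈L⁻ (there m) with nD , _ , cofactor ← ∈Ds⁻ m = nD , cofactor
  ∈L⁺ : ∀ {D} → Normalised D → SquareFreeCofactor A D → D ∈ L
  ∈L⁺ {D} nD cofactor with ListP.≡-dec BoolP._≟_ D A₀
  ... | yes D≡A₀ = here D≡A₀
  ... | no D≢A₀ = there (∈Ds⁺ nD (λ D≈A → D≢A₀ (trans (sym nD) D≈A)) cofactor)
  A₀-term : σ A₀ *ₚ (A ÷ A₀) ≐ A
  A₀-term = ≐-trans (*ₚ-congˡ (A ÷ A₀) (≐-trans (σ-resp (nonZero-resp (≐-sym (norm-≐ A)) nA) (norm-≐ A)) (≈⇒≐ {σ A} {A} perfect)))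
           (≐-trans (*ₚ-congʳ A (÷-cofactor A A₀ oneₚ nA A₀≐A)) (*ₚ-identityʳ A))

corollary4p7 : (A : Poly) → Odd A → Perfect A →
    (Ds : List Poly) → Unique Ds →
    (∀ D → (D ∈ Ds) ⇔ (Normalised D × D ∣ A × ¬ (D ≈ A) × ∃ (λ Q → (Q *ₚ D) ≈ A × SquareFree Q))) →
    ((A +ₚ oneₚ) , A) ≈f sumF (map (λ D → (σ D , D)) Ds)
corollary4p7 A (nA , _) perfect Ds uDs Ds-spec = ≐⇒≈ (≐-sym (begin
  n *ₚ A                               ≈⟨ sumF-over-divisors A σ Ds divides ⟩
  d *ₚ sumₚ (λ D → σ D *ₚ (A ÷ D)) Ds  ≈⟨ *ₚ-congʳ d (sumₚ-σ-properSquareFreeCofactors A nA perfect uDs ∈Ds⇒cofactor cofactor⇒∈Ds) ⟩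
  d *ₚ (A +ₚ oneₚ)                     ≈⟨ *ₚ-comm d (A +ₚ oneₚ) ⟩
  (A +ₚ oneₚ) *ₚ d                     ∎))
  where
  open ≐-Reasoning
  n = proj₁ (sumF (map (λ D → (σ D , D)) Ds))
  d = proj₂ (sumF (map (λ D → (σ D , D)) Ds))
  ∈Ds⇒cofactor : ∀ {D} → D ∈ Ds → Normalised D × ¬ (D ≈ A) × SquareFreeCofactor A D
  ∈Ds⇒cofactor m with nD , _ , D≉A , Q , QD≈A , sqQ ← Equivalence.to (Ds-spec _) m = nD , D≉A , Q , ≈⇒≐ QD≈A , sqQ
  cofactor⇒∈Ds : ∀ {D} → Normalised D → ¬ (D ≈ A) → SquareFreeCofactor A D → D ∈ Ds
  cofactor⇒∈Ds nD D≉A (Q , QD≐A , sqQ) = Equivalence.from (Ds-spec _) (nD , ∣ₚ⇒∣ (Q , QD≐A) , D≉A , Q , ≐⇒≈ QD≐A , sqQ)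
  divides : ∀ {D} → D ∈ Ds → (A ÷ D) *ₚ D ≐ A
  divides m with _ , _ , Q , QD≐A , _ ← ∈Ds⇒cofactor m = ÷-*ₚ A _ nA (Q , QD≐A)
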